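{- Q-PC p-simulates QNS with respect to the size and the Q-size measures.
   Context: A QBF $\mathcal Q.\phi$: quantifier prefix $\mathcal Q$ quantifying each variable of a finite set $V$ exactly once (existentially or universally, in a linear order), CNF $\phi$ over $V$. For each $v$ let $\overline v$ be a twin variable; a clause $C=\bigvee_{v\in P}v\vee\bigvee_{v\in N}\neg v$ is encoded as $\mathrm{enc}(C)=\{\prod_{v\in P}\overline v\prod_{v\in N}v\}\cup\{v^2-v,\ v+\overline v-1: v\in P\cup N\}$ and $\mathrm{enc}(\phi)=\bigcup_{C\in\phi}\mathrm{enc}(C)$. A QNS refutation is a polynomial identity in $\mathbb Q[V\cup\overline V]$ of the form $\sum_{p\in \mathrm{enc}(\phi)}q_pp+\sum_{u}q_u(1-2u)+1=0$, $u$ ranging over universal variables, every variable $v$ or $\overline v$ in $q_u$ having $v$ quantified left of $u$; size = number of monomials (with repetition) in the $q_p,q_u$; Q-size = number of monomials in the $q_u$. A Q-PC (Q-Polynomial Calculus over $\mathbb Q$) refutation is a sequence of polynomials deriving $1$ from $\mathrm{enc}(\phi)$ with the rules: from $p,q$ derive $p+q$; from $p$ derive $vp$ for a variable $v$ or $v\in\mathbb Q$; and $\forall$-reduction: from $p$ derive $p|_{u=b}$, $b\in\{0,1\}$, where $u$ is universal and all variables of $p$ other than $u$ are quantified left of $u$. Its size is the number of monomials (with repetition) in it, and its Q-size the number of monomials in polynomials involved in $\forall$-reduction steps. A system $P$ p-simulates $Q$ w.r.t.\ a measure $\mu$ if there is a polynomial $r$ such that for every false QBF $\Phi$ and every $Q$-refutation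 $\pi$ of $\Phi$ there is a $P$-refutation $\pi'$ of $\Phi$ with $\mu(\pi')\le r(\mu(\pi)+|\Phi|)$. -}

module Defs where

open import Data.Bool using (Bool; true; false; if_then_else_; _∨_; _∧_; not)
open import Data.Nat using (ℕ; zero; suc; _≤_) renaming (_+_ to _+ℕ_; _*_ to _*ℕ_)
import Data.Nat.Properties as ℕP
open import Data.Integer using (+_)
open import Data.Rational using (ℚ; 0ℚ; 1ℚ; _/_) renaming (_+_ to _+ℚ_; _*_ to _*ℚ_; -_ to -ℚ_)
import Data.Rational.Properties as ℚP
open import Data.Fin using (Fin) renaming (_<_ to _<F_; _≤_ to _≤F_)
import Data.Fin.Properties as FinP
open import Data.Vec using (Vec; []; _∷_; lookup; replicate; zipWith; updateAt; count; toList) renaming (_[_]≔_ to _[_]≔V_)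
import Data.Vec.Properties as VecP
open import Data.List using (List; []; _∷_; _++_; map; concatMap; filter; deduplicate; length; allFin; foldr)
  renaming (zipWith to zipWithL)
open import Data.Nat.ListAction using (sum)
open import Data.Bool.ListAction using (any)
open import Data.List.Membership.Propositional using (_∈_)
open import Data.Product using (Σ; _×_; _,_; proj₁; proj₂; ∃)
import Data.Product.Properties as ProdP
open import Relation.Binary.PropositionalEquality using (_≡_; _≢_)
open import Relation.Nullary using (¬_; ¬?)
open import Relation.Binary.Definitions using (DecidableEquality)
open import Data.Empty using (⊥)

-- QBFs.  Variables are Fin n, numbered in the order of the quantifier
-- prefix: variable i is quantified at position i (index 0 = outermost).

data Quant : Set where
  ∃q ∀q : Quant

isUniv : Quant → Bool
isUniv ∃q = false
isUniv ∀q = true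

record Clause (n : ℕ) : Set where
  constructor clause
  field
    pos : Vec Bool n
    neg : Vec Bool n

CNF : ℕ → Set
CNF n = List (Clause n)

record QBF (n : ℕ) : Set where
  constructor qbf
  field
    prefix : Vec Quant n
    matrix : CNF n

Universal : ∀ {n} → QBF n → Fin n → Set
Universal Φ u = lookup (QBF.prefix Φ) u ≡ ∀q

clauseTrue : ∀ {n} → Vec Bool n → Clause n → Bool
clauseTrue {n} α (clause P N) =
  any (λ i → (lookup P i ∧ lookup α i) ∨ (lookup N i ∧ not (lookup α i))) (allFin n)

cnfTrue : ∀ {n} → CNF n → Vec Bool n → Bool
cnfTrue φ α = foldr (λ C b → clauseTrue α C ∧ b) true φ

prefixTrue : ∀ {k} → Vec Quant k → (Vec Bool k → Bool) → Set
prefixTrue []        f = f [] ≡ true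
prefixTrue (∃q ∷ qs) f = Σ Bool λ b → prefixTrue qs (λ bs → f (b ∷ bs))
prefixTrue (∀q ∷ qs) f = (b : Bool) → prefixTrue qs (λ bs → f (b ∷ bs))

QBFTrue : ∀ {n} → QBF n → Set
QBFTrue (qbf Q φ) = prefixTrue Q (cnfTrue φ)

QBFFalse : ∀ {n} → QBF n → Set
QBFFalse Φ = ¬ QBFTrue Φ

qbfSize : ∀ {n} → QBF n → ℕ
qbfSize {n} (qbf Q φ) = n +ℕ sum (map (λ C → suc (count (λ b → Data.Bool._≟_ b true) (Clause.pos C)
                                             +ℕ count (λ b → Data.Bool._≟_ b true) (Clause.neg C))) φ)
  where import Data.Bool

-- Polynomials in ℚ[V ∪ V̄].
-- A monomial is a pair of exponent vectors (exponents of v, exponents of v̄).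
-- A polynomial is a finite list of terms (coefficient, monomial); two
-- representations denote the same polynomial iff all coefficients agree.

Mono : ℕ → Set
Mono n = Vec ℕ n × Vec ℕ n

_≟M_ : ∀ {n} → DecidableEquality (Mono n)
_≟M_ = ProdP.≡-dec (VecP.≡-dec ℕP._≟_) (VecP.≡-dec ℕP._≟_)

Poly : ℕ → Set
Poly n = List (ℚ × Mono n)

-- twin flag: (i , false) is v_i, (i , true) is v̄_i
Var : ℕ → Set
Var n = Fin n × Bool

oneM : ∀ {n} → Mono n
oneM = replicate _ 0 , replicate _ 0

varM : ∀ {n} → Var n → Mono n
varM (i , false) = (replicate _ 0 [ i ]≔V 1) , replicate _ 0
varM (i , true)  = replicate _ 0 , (replicate _ 0 [ i ]≔V 1)

_·M_ : ∀ {n} → Mono n → Mono n → Mono n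
(a , b) ·M (c , d) = zipWith _+ℕ_ a c , zipWith _+ℕ_ b d

coeff : ∀ {n} → Poly n → Mono n → ℚ
coeff [] m = 0ℚ
coeff ((c , m') ∷ p) m with m' ≟M m
... | Relation.Nullary.yes _ = c +ℚ coeff p m
... | Relation.Nullary.no  _ = coeff p m

_≈P_ : ∀ {n} → Poly n → Poly n → Set
p ≈P q = ∀ m → coeff p m ≡ coeff q m

nmon : ∀ {n} → Poly n → ℕ
nmon p = length (deduplicate _≟M_ (filter (λ m → ¬? (coeff p m ℚP.≟ 0ℚ)) (map proj₂ p)))

zeroP : ∀ {n} → Poly n
zeroP = []

constP : ∀ {n} → ℚ → Poly n
constP c = (c , oneM) ∷ []

varP : ∀ {n} → Var n → Poly n
varP x = (1ℚ , varM x) ∷ []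

infixr 6 _⊕_
infixr 7 _⊗_
infix 4 _≈P_

_⊕_ : ∀ {n} → Poly n → Poly n → Poly n
p ⊕ q = p ++ q

_⊗_ : ∀ {n} → Poly n → Poly n → Poly n
p ⊗ q = concatMap (λ t → map (λ s → (proj₁ t *ℚ proj₁ s , proj₂ t ·M proj₂ s)) q) p

sumP : ∀ {n} → List (Poly n) → Poly n
sumP = foldr _⊕_ zeroP

-- p|_{u=b}  (substitute the constant b for the variable u, not touching ū)
restrict : ∀ {n} → Poly n → Fin n → Bool → Poly n
restrict [] u b = []
restrict ((c , (e , e̅)) ∷ p) u b with lookup e u
... | zero  = (c , (e , e̅)) ∷ restrict p u b
... | suc _ = if b then (c , ((e [ u ]≔V 0) , e̅)) ∷ restrict p u b else restrict p u b

ScopedBefore : ∀ {n} → Poly n → Fin n → Set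
ScopedBefore {n} p u = ∀ m → coeff p m ≢ 0ℚ → (i : Fin n) → u ≤F i →
  (lookup (proj₁ m) i ≡ 0) × (lookup (proj₂ m) i ≡ 0)

-- all variables of p other than u are quantified left of u
-- (in particular ū does not occur, since ū is a variable other than u
--  whose underlying variable is not left of u)
ScopedExcept : ∀ {n} → Poly n → Fin n → Set
ScopedExcept {n} p u = ∀ m → coeff p m ≢ 0ℚ →
  (lookup (proj₂ m) u ≡ 0) ×
  ((i : Fin n) → u <F i → (lookup (proj₁ m) i ≡ 0) × (lookup (proj₂ m) i ≡ 0))

boolAx : ∀ {n} → Fin n → Poly n
boolAx i = (1ℚ , (varM (i , false) ·M varM (i , false))) ∷ (-ℚ 1ℚ , varM (i , false)) ∷ []

twinAx : ∀ {n} → Fin n → Poly n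
twinAx i = (1ℚ , varM (i , false)) ∷ (1ℚ , varM (i , true)) ∷ (-ℚ 1ℚ , oneM) ∷ []

clauseMono : ∀ {n} → Clause n → Poly n
clauseMono (clause P N) =
  (1ℚ , (Data.Vec.map (λ b → if b then 1 else 0) N , Data.Vec.map (λ b → if b then 1 else 0) P)) ∷ []
  where import Data.Vec

encC : ∀ {n} → Clause n → List (Poly n)
encC {n} (clause P N) = clauseMono (clause P N) ∷
  concatMap (λ i → if lookup P i ∨ lookup N i then boolAx i ∷ twinAx i ∷ [] else []) (allFin n)

enc : ∀ {n} → CNF n → List (Poly n)
enc = concatMap encC

oneMinus2 : ∀ {n} → Fin n → Poly n
oneMinus2 u = (1ℚ , oneM) ∷ (-ℚ (+ 2 / 1) , varM (u , false)) ∷ []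

_≟Q_ : DecidableEquality Quant
∃q ≟Q ∃q = Relation.Nullary.yes Relation.Binary.PropositionalEquality.refl
∃q ≟Q ∀q = Relation.Nullary.no (λ ())
∀q ≟Q ∃q = Relation.Nullary.no (λ ())
∀q ≟Q ∀q = Relation.Nullary.yes Relation.Binary.PropositionalEquality.refl

univList : ∀ {n} → QBF n → List (Fin n)
univList {n} Φ = filter (λ u → lookup (QBF.prefix Φ) u ≟Q ∀q) (allFin n)

record QNS {n} (Φ : QBF n) : Set where
  field
    qp      : List (Poly n)
    qpLen   : length qp ≡ length (enc (QBF.matrix Φ))
    -- q_u for each variable u (only used for universal u)
    qu      : Fin n → Poly n
    quScope : ∀ u → Universal Φ u → ScopedBefore (qu u) u
    identity : (sumP (zipWithL _⊗_ qp (enc (QBF.matrix Φ)))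
                 ⊕ sumP (map (λ u → qu u ⊗ oneMinus2 u) (univList Φ))
                 ⊕ constP 1ℚ) ≈P zeroP

QNSQsize : ∀ {n} {Φ : QBF n} → QNS Φ → ℕ
QNSQsize {Φ = Φ} π = sum (map (λ u → nmon (QNS.qu π u)) (univList Φ))

QNSsize : ∀ {n} {Φ : QBF n} → QNS Φ → ℕ
QNSsize π = sum (map nmon (QNS.qp π)) +ℕ QNSQsize π

-- Q-PC over ℚ.  A derivation is built line by line; `prev` is the list of
-- previously derived lines (most recent first).

data Step {n} (Φ : QBF n) (prev : List (Poly n)) : Poly n → Set where
  axiom : ∀ {p q} → q ∈ enc (QBF.matrix Φ) → p ≈P q → Step Φ prev p
  add   : ∀ {p a b} → a ∈ prev → b ∈ prev → p ≈P (a ⊕ b) → Step Φ prev p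
  mulV  : ∀ {p a} (x : Var n) → a ∈ prev → p ≈P (varP x ⊗ a) → Step Φ prev p
  mulQ  : ∀ {p a} (c : ℚ) → a ∈ prev → p ≈P (constP c ⊗ a) → Step Φ prev p
  ∀red  : ∀ {p a} (u : Fin n) (b : Bool) → Universal Φ u → a ∈ prev →
          ScopedExcept a u → p ≈P restrict a u b → Step Φ prev p

data Deriv {n} (Φ : QBF n) : List (Poly n) → Set where
  []  : Deriv Φ []
  _▷_ : ∀ {ls p} → Deriv Φ ls → Step Φ ls p → Deriv Φ (p ∷ ls)

stepQsize : ∀ {n} {Φ : QBF n} {prev p} → Step Φ prev p → ℕ
stepQsize {p = p} (∀red {a = a} _ _ _ _ _ _) = nmon a +ℕ nmon p
stepQsize _ = 0

derivQsize : ∀ {n} {Φ : QBF n} {ls} → Deriv Φ ls → ℕ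
derivQsize [] = 0
derivQsize (d ▷ s) = derivQsize d +ℕ stepQsize s

record QPC {n} (Φ : QBF n) : Set where
  field
    lastLine : Poly n
    earlier  : List (Poly n)
    deriv    : Deriv Φ (lastLine ∷ earlier)
    isOne    : lastLine ≈P constP 1ℚ

QPCsize : ∀ {n} {Φ : QBF n} → QPC Φ → ℕ
QPCsize π = sum (map nmon (QPC.lastLine π ∷ QPC.earlier π))

QPCQsize : ∀ {n} {Φ : QBF n} → QPC Φ → ℕ
QPCQsize π = derivQsize (QPC.deriv π)

evalPoly : List ℕ → ℕ → ℕ
evalPoly [] x = 0
evalPoly (a ∷ as) x = a +ℕ x *ℕ evalPoly as x

PSimulates : (R₁ R₂ : ∀ {n} → QBF n → Set)
             (μ₁ : ∀ {n} {Φ : QBF n} → R₁ Φ → ℕ) (μ₂ : ∀ {n} {Φ : QBF n} → R₂ Φ → ℕ) → Set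
PSimulates R₁ R₂ μ₁ μ₂ = Σ (List ℕ) λ r →
  ∀ (n : ℕ) (Φ : QBF n) → QBFFalse Φ → (π : R₂ Φ) →
    Σ (R₁ Φ) λ π′ → μ₁ π′ ≤ evalPoly r (μ₂ π +ℕ qbfSize Φ)

-- Multilinearisation (lowering every exponent to 1) is a linear map on polynomials.  Applied
-- to a QNS identity  Σ q_p p + Σ q_u (1 − 2u) + 1 = 0  it kills every product with a boolean
-- axiom v² − v, and, once q_u is normalised, it commutes with multiplication by 1 − 2u because
-- q_u only mentions variables left of u.  What remains says that Σ multilin(q_p p) equals
-- −1 − Σ multilin(q_u) (1 − 2u).  Each multilinear product multilin(m·p), for a monomial m and a
-- clause monomial or twin axiom v + v̄ − 1, is derived in Q-PC from p by multiplying with at most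
-- 2n single variables (using v (v + v̄ − 1) − (v² − v) = v v̄ when m already contains v or v̄),
-- and these are added up.  ∀-reducing the innermost remaining universal u to 0 and to 1 and
-- averaging cancels multilin(q_u) (1 − 2u); after all universals only −1 is left.  Every line
-- has O(Σ|q_p| + n) or O(Σ|q_u|) monomials, so both the size and the Q-size of the Q-PC
-- refutation are quadratic.

module Submission where

open import Defs
open import Data.Bool using (Bool; true; false; if_then_else_; not; _∨_)
import Data.Bool.Properties as BoolP
open import Data.Nat using (ℕ; zero; suc; _+_; _*_; _∸_; _≤_; z≤n; s≤s)
import Data.Nat.Properties as ℕP
open import Data.Nat.ListAction using (sum)
import Data.Nat.ListAction.Properties as SumP
import Data.Nat.Solver
open import Data.Fin using (Fin; zero; suc) renaming (_≟_ to _≟F_; _<_ to _<F_; _≤_ to _≤F_)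
open import Data.Vec using (Vec; []; _∷_; lookup; replicate) renaming (map to mapᵥ; zipWith to zipWithᵥ; _[_]≔_ to _[_]≔ᵥ_)
import Data.Vec.Properties as VecP
import Data.Integer as ℤ
open import Data.Rational using (ℚ; 0ℚ; 1ℚ; _/_) renaming (_+_ to _+ℚ_; _*_ to _*ℚ_; -_ to -ℚ_)
import Data.Rational.Properties as ℚP
import Data.Rational.Solver as ℚSolver
open import Data.List using (List; []; _∷_; _++_; map; concatMap; filter; deduplicate; length; reverse; allFin; zipWith)
import Data.List.Properties as LP
open import Data.List.Membership.Propositional using (_∈_; _∉_; find; lose)
open import Data.List.Membership.Propositional.Properties
  using (∈-++⁺ˡ; ∈-++⁺ʳ; ∈-∃++; ∈-filter⁺; ∈-filter⁻; ∈-deduplicate⁺; ∈-deduplicate⁻; ∈-map⁻; ∈-concatMap⁺; ∈-concatMap⁻)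
import Data.List.Membership.DecPropositional as DecMembership
open import Data.List.Relation.Binary.Subset.Propositional using (_⊆_)
open import Data.List.Relation.Binary.Permutation.Propositional using (↭-sym)
open import Data.List.Relation.Binary.Permutation.Propositional.Properties using (↭-reverse; All-resp-↭)
open import Data.List.Relation.Unary.Any using (here; there)
open import Data.List.Relation.Unary.All using (All; []; _∷_; tabulate) renaming (map to mapᴬ; lookup to lookupᴬ)
import Data.List.Relation.Unary.All.Properties as AllP
open import Data.List.Relation.Unary.AllPairs using (AllPairs; []; _∷_)
import Data.List.Relation.Unary.AllPairs.Properties as AllPairsP
open import Data.List.Relation.Unary.Unique.Propositional using (Unique)
open import Data.List.Relation.Unary.Unique.DecPropositional.Properties using (deduplicate-!)
open import Data.Product using (Σ; ∃; _×_; _,_; proj₁; proj₂; map₂)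
import Data.Product.Properties as ProdP
open import Data.Empty using (⊥-elim)
open import Function using (id; case_of_)
open import Level using (0ℓ)
open import Relation.Binary.Bundles using (Setoid)
open import Relation.Binary.Definitions using (DecidableEquality)
open import Relation.Binary.PropositionalEquality
import Relation.Binary.Reasoning.Setoid as SetoidReasoning
open import Relation.Nullary using (yes; no; ¬?)

module NatSolver = Data.Nat.Solver.+-*-Solver

-- Coefficients and coefficientwise equality

module _ {n : ℕ} where

  -- Opaque, so that δᴹ-refl and δᴹ-≢ can be used with rewrite.
  opaque
    δᴹ : Mono n → Mono n → ℚ
    δᴹ m d with m ≟M d
    ... | yes _ = 1ℚ
    ... | no  _ = 0ℚ

    δᴹ-refl : ∀ m → δᴹ m m ≡ 1ℚ
    δᴹ-refl m with m ≟M m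
    ... | yes _  = refl
    ... | no m≢m = ⊥-elim (m≢m refl)

    δᴹ-≢ : ∀ {m d} → m ≢ d → δᴹ m d ≡ 0ℚ
    δᴹ-≢ {m} {d} m≢d with m ≟M d
    ... | yes m≡d = ⊥-elim (m≢d m≡d)
    ... | no  _   = refl

    δᴹ-sym : ∀ m d → δᴹ m d ≡ δᴹ d m
    δᴹ-sym m d with m ≟M d
    ... | yes refl = sym (δᴹ-refl m)
    ... | no  m≢d  = sym (δᴹ-≢ (λ d≡m → m≢d (sym d≡m)))

    coeff-∷ : ∀ c m (p : Poly n) d → coeff ((c , m) ∷ p) d ≡ c *ℚ δᴹ m d +ℚ coeff p d
    coeff-∷ c m p d with m ≟M d
    ... | yes _ = cong (_+ℚ coeff p d) (sym (ℚP.*-identityʳ c))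
    ... | no  _ = sym (trans (cong (_+ℚ coeff p d) (ℚP.*-zeroʳ c)) (ℚP.+-identityˡ _))

  coeff-[] : ∀ c m d → coeff {n} ((c , m) ∷ []) d ≡ c *ℚ δᴹ m d
  coeff-[] c m d = trans (coeff-∷ c m [] d) (ℚP.+-identityʳ _)

  coeff-++ : ∀ (p q : Poly n) d → coeff (p ++ q) d ≡ coeff p d +ℚ coeff q d
  coeff-++ []            q d = sym (ℚP.+-identityˡ _)
  coeff-++ ((c , m) ∷ p) q d with m ≟M d
  ... | yes _ = trans (cong (c +ℚ_) (coeff-++ p q d)) (sym (ℚP.+-assoc c _ _))
  ... | no  _ = coeff-++ p q d

  monos : Poly n → List (Mono n)
  monos = map proj₂

  coeff-∉ : ∀ (p : Poly n) {d} → d ∉ monos p → coeff p d ≡ 0ℚ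
  coeff-∉ []            d∉ = refl
  coeff-∉ ((c , m) ∷ p) {d} d∉ with m ≟M d
  ... | yes refl = ⊥-elim (d∉ (here refl))
  ... | no  _    = coeff-∉ p (λ d∈ → d∉ (there d∈))

  -- Wrapping ≈P in a record lets unification recover both polynomials (coeff is not injective).
  infix 4 _≃_
  record _≃_ (p q : Poly n) : Set where
    constructor coeffwise
    field ≃⇒≈P : p ≈P q

  open _≃_ public

  ≃-setoid : Setoid 0ℓ 0ℓ
  ≃-setoid = record
    { Carrier       = Poly n
    ; _≈_           = _≃_
    ; isEquivalence = record
      { refl  = coeffwise (λ _ → refl)
      ; sym   = λ p≃q → coeffwise (λ d → sym (≃⇒≈P p≃q d))
      ; trans = λ p≃q q≃r → coeffwise (λ d → trans (≃⇒≈P p≃q d) (≃⇒≈P q≃r d))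
      }
    }

  open Setoid ≃-setoid public using () renaming (refl to ≃-refl; sym to ≃-sym; trans to ≃-trans)

  ≡⇒≃ : ∀ {p q : Poly n} → p ≡ q → p ≃ q
  ≡⇒≃ refl = ≃-refl

  sumOver : List (Mono n) → (Mono n → ℚ) → ℚ
  sumOver []      g = 0ℚ
  sumOver (d ∷ D) g = g d +ℚ sumOver D g

  sumOver-cong : ∀ D {g h} → (∀ d → g d ≡ h d) → sumOver D g ≡ sumOver D h
  sumOver-cong []      g≗h = refl
  sumOver-cong (d ∷ D) g≗h = cong₂ _+ℚ_ (g≗h d) (sumOver-cong D g≗h)

  sumOver-+ : ∀ D (g h : Mono n → ℚ) → sumOver D (λ d → g d +ℚ h d) ≡ sumOver D g +ℚ sumOver D h
  sumOver-+ []      g h = refl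
  sumOver-+ (d ∷ D) g h = trans (cong (g d +ℚ h d +ℚ_) (sumOver-+ D g h))
    (solve 4 (λ a b c e → (a :+ b) :+ (c :+ e) := (a :+ c) :+ (b :+ e)) refl (g d) (h d) (sumOver D g) (sumOver D h))
    where open ℚSolver.+-*-Solver

  sumOver-zero : ∀ D → sumOver D (λ _ → 0ℚ) ≡ 0ℚ
  sumOver-zero []      = refl
  sumOver-zero (d ∷ D) = trans (ℚP.+-identityˡ _) (sumOver-zero D)

  sumOver-δᴹ-∉ : ∀ D {m} (h : Mono n → ℚ) → m ∉ D → sumOver D (λ d → δᴹ m d *ℚ h d) ≡ 0ℚ
  sumOver-δᴹ-∉ []      h m∉ = refl
  sumOver-δᴹ-∉ (d ∷ D) h m∉
    rewrite δᴹ-≢ (λ m≡d → m∉ (here m≡d)) | sumOver-δᴹ-∉ D h (λ m∈ → m∉ (there m∈))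
    = trans (ℚP.+-identityʳ _) (ℚP.*-zeroˡ (h d))

  sumOver-δᴹ : ∀ D {m} (h : Mono n → ℚ) → Unique D → m ∈ D → sumOver D (λ d → δᴹ m d *ℚ h d) ≡ h m
  sumOver-δᴹ (d ∷ D) {m} h (d∉D ∷ D!) (here refl)
    rewrite δᴹ-refl m | sumOver-δᴹ-∉ D h (AllP.All¬⇒¬Any d∉D)
    = trans (ℚP.+-identityʳ _) (ℚP.*-identityˡ (h m))
  sumOver-δᴹ (d ∷ D) {m} h (d∉D ∷ D!) (there m∈D)
    rewrite δᴹ-≢ {m} {d} (λ { refl → AllP.All¬⇒¬Any d∉D m∈D }) | sumOver-δᴹ D h D! m∈D
    = trans (cong (_+ℚ h m) (ℚP.*-zeroˡ (h d))) (ℚP.+-identityˡ (h m))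

  linExt : (Mono n → ℚ) → Poly n → ℚ
  linExt f []            = 0ℚ
  linExt f ((c , m) ∷ p) = c *ℚ f m +ℚ linExt f p

  linExt-sumOver : ∀ f D (p : Poly n) → Unique D → All (_∈ D) (monos p) →
                   linExt f p ≡ sumOver D (λ d → coeff p d *ℚ f d)
  linExt-sumOver f D []            _  _ =
    sym (trans (sumOver-cong D (λ d → ℚP.*-zeroˡ (f d))) (sumOver-zero D))
  linExt-sumOver f D ((c , m) ∷ p) D! (m∈D ∷ p⊆D) = sym (begin
    sumOver D (λ d → coeff ((c , m) ∷ p) d *ℚ f d)
      ≡⟨ sumOver-cong D (λ d → trans (cong (_*ℚ f d) (coeff-∷ c m p d)) (split c (δᴹ m d) (coeff p d) (f d))) ⟩
    sumOver D (λ d → δᴹ m d *ℚ (c *ℚ f d) +ℚ coeff p d *ℚ f d)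
      ≡⟨ sumOver-+ D (λ d → δᴹ m d *ℚ (c *ℚ f d)) (λ d → coeff p d *ℚ f d) ⟩
    sumOver D (λ d → δᴹ m d *ℚ (c *ℚ f d)) +ℚ sumOver D (λ d → coeff p d *ℚ f d)
      ≡⟨ cong₂ _+ℚ_ (sumOver-δᴹ D (λ d → c *ℚ f d) D! m∈D) (sym (linExt-sumOver f D p D! p⊆D)) ⟩
    c *ℚ f m +ℚ linExt f p ∎)
    where
    open ≡-Reasoning
    open ℚSolver.+-*-Solver
    split : ∀ c x y z → (c *ℚ x +ℚ y) *ℚ z ≡ x *ℚ (c *ℚ z) +ℚ y *ℚ z
    split = solve 4 (λ c x y z → (c :* x :+ y) :* z := x :* (c :* z) :+ y :* z) refl

  linExt-resp-≃ : ∀ f {p q : Poly n} → p ≃ q → linExt f p ≡ linExt f q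
  linExt-resp-≃ f {p} {q} p≃q = begin
    linExt f p                           ≡⟨ linExt-sumOver f D p D! (tabulate (λ m∈ → ∈-deduplicate⁺ _≟M_ (∈-++⁺ˡ m∈))) ⟩
    sumOver D (λ d → coeff p d *ℚ f d)   ≡⟨ sumOver-cong D (λ d → cong (_*ℚ f d) (≃⇒≈P p≃q d)) ⟩
    sumOver D (λ d → coeff q d *ℚ f d)   ≡⟨ linExt-sumOver f D q D! (tabulate (λ m∈ → ∈-deduplicate⁺ _≟M_ (∈-++⁺ʳ (monos p) m∈))) ⟨
    linExt f q                           ∎
    where
    open ≡-Reasoning
    D  = deduplicate _≟M_ (monos p ++ monos q)
    D! = deduplicate-! _≟M_ (monos p ++ monos q)

  ⊕-cong : ∀ {p p′ q q′ : Poly n} → p ≃ p′ → q ≃ q′ → p ⊕ q ≃ p′ ⊕ q′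
  ⊕-cong {p} {p′} {q} {q′} p≃p′ q≃q′ = coeffwise λ d → begin
    coeff (p ++ q) d             ≡⟨ coeff-++ p q d ⟩
    coeff p d +ℚ coeff q d       ≡⟨ cong₂ _+ℚ_ (≃⇒≈P p≃p′ d) (≃⇒≈P q≃q′ d) ⟩
    coeff p′ d +ℚ coeff q′ d     ≡⟨ coeff-++ p′ q′ d ⟨
    coeff (p′ ++ q′) d           ∎
    where open ≡-Reasoning

  ⊕-assoc : ∀ (p q r : Poly n) → (p ⊕ q) ⊕ r ≃ p ⊕ (q ⊕ r)
  ⊕-assoc p q r = ≡⇒≃ (LP.++-assoc p q r)

  ⊕-identityʳ : ∀ {p z : Poly n} → z ≃ zeroP → p ⊕ z ≃ p
  ⊕-identityʳ {p} {z} z≃0 = ≃-trans (⊕-cong (≃-refl {p}) z≃0) (≡⇒≃ (LP.++-identityʳ p))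

  TermwiseLinear : (ℚ × Mono n → Poly n) → Set
  TermwiseLinear g = ∀ c m d → coeff (g (c , m)) d ≡ c *ℚ coeff (g (1ℚ , m)) d

  coeff-concatMap : ∀ {g} → TermwiseLinear g → ∀ p d →
                    coeff (concatMap g p) d ≡ linExt (λ m → coeff (g (1ℚ , m)) d) p
  coeff-concatMap         lin []            d = refl
  coeff-concatMap {g = g} lin ((c , m) ∷ p) d =
    trans (coeff-++ (g (c , m)) (concatMap g p) d) (cong₂ _+ℚ_ (lin c m d) (coeff-concatMap lin p d))

  concatMap-resp-≃ : ∀ {g} → TermwiseLinear g → ∀ {p q} → p ≃ q → concatMap g p ≃ concatMap g q
  concatMap-resp-≃ {g} lin {p} {q} p≃q = coeffwise λ d →
    trans (coeff-concatMap lin p d)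
      (trans (linExt-resp-≃ (λ m → coeff (g (1ℚ , m)) d) p≃q) (sym (coeff-concatMap lin q d)))

-- Exponents and multilinearisation of monomials

clip : ℕ → ℕ
clip zero    = 0
clip (suc _) = 1

module _ {n : ℕ} where

  expo : Mono n → Var n → ℕ
  expo m (i , false) = lookup (proj₁ m) i
  expo m (i , true)  = lookup (proj₂ m) i

  Mono-ext : ∀ {a b : Mono n} → (∀ x → expo a x ≡ expo b x) → a ≡ b
  Mono-ext a≗b = cong₂ _,_ (Vec-ext (λ i → a≗b (i , false))) (Vec-ext (λ i → a≗b (i , true)))
    where
    Vec-ext : ∀ {u v : Vec ℕ n} → (∀ i → lookup u i ≡ lookup v i) → u ≡ v
    Vec-ext {u} {v} u≗v = trans (sym (VecP.tabulate∘lookup u)) (trans (VecP.tabulate-cong u≗v) (VecP.tabulate∘lookup v))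

  expo-·M : ∀ (a b : Mono n) x → expo (a ·M b) x ≡ expo a x + expo b x
  expo-·M a b (i , false) = VecP.lookup-zipWith _+_ i (proj₁ a) (proj₁ b)
  expo-·M a b (i , true)  = VecP.lookup-zipWith _+_ i (proj₂ a) (proj₂ b)

  expo-oneM : ∀ x → expo (oneM {n}) x ≡ 0
  expo-oneM (i , false) = VecP.lookup-replicate i 0
  expo-oneM (i , true)  = VecP.lookup-replicate i 0

  _≟ⱽ_ : DecidableEquality (Var n)
  _≟ⱽ_ = ProdP.≡-dec _≟F_ BoolP._≟_

  opaque
    δⱽ : Var n → Var n → ℕ
    δⱽ x y with x ≟ⱽ y
    ... | yes _ = 1
    ... | no  _ = 0

    δⱽ-refl : ∀ x → δⱽ x x ≡ 1
    δⱽ-refl x with x ≟ⱽ x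
    ... | yes _  = refl
    ... | no x≢x = ⊥-elim (x≢x refl)

    δⱽ-≢ : ∀ {x y} → x ≢ y → δⱽ x y ≡ 0
    δⱽ-≢ {x} {y} x≢y with x ≟ⱽ y
    ... | yes x≡y = ⊥-elim (x≢y x≡y)
    ... | no  _   = refl

    expo-varM : ∀ x y → expo (varM x) y ≡ δⱽ x y
    expo-varM x y with x ≟ⱽ y
    ... | yes refl = expo-varM-self x
      where
      expo-varM-self : ∀ x → expo (varM x) x ≡ 1
      expo-varM-self (i , false) = VecP.lookup∘update i (replicate n 0) 1
      expo-varM-self (i , true)  = VecP.lookup∘update i (replicate n 0) 1
    ... | no x≢y = expo-varM-other x y x≢y
      where
      unit-off : ∀ {i j} → i ≢ j → lookup (replicate n 0 [ i ]≔ᵥ 1) j ≡ 0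
      unit-off {i} {j} i≢j = trans (VecP.lookup∘update′ (λ j≡i → i≢j (sym j≡i)) (replicate n 0) 1) (VecP.lookup-replicate j 0)
      expo-varM-other : ∀ x y → x ≢ y → expo (varM x) y ≡ 0
      expo-varM-other (i , false) (j , false) x≢y = unit-off (λ i≡j → x≢y (cong (_, false) i≡j))
      expo-varM-other (i , true)  (j , true)  x≢y = unit-off (λ i≡j → x≢y (cong (_, true) i≡j))
      expo-varM-other (i , false) (j , true)  _   = VecP.lookup-replicate j 0
      expo-varM-other (i , true)  (j , false) _   = VecP.lookup-replicate j 0

  ·M-identityˡ : ∀ (m : Mono n) → oneM ·M m ≡ m
  ·M-identityˡ m = Mono-ext λ x → trans (expo-·M oneM m x) (cong (_+ expo m x) (expo-oneM x))

  ·M-identityʳ : ∀ (m : Mono n) → m ·M oneM ≡ m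
  ·M-identityʳ m = Mono-ext λ x → trans (expo-·M m oneM x) (trans (cong (expo m x +_) (expo-oneM x)) (ℕP.+-identityʳ _))

  ·M-assoc : ∀ (a b c : Mono n) → (a ·M b) ·M c ≡ a ·M (b ·M c)
  ·M-assoc a b c = Mono-ext λ x → begin
    expo ((a ·M b) ·M c) x             ≡⟨ trans (expo-·M (a ·M b) c x) (cong (_+ expo c x) (expo-·M a b x)) ⟩
    expo a x + expo b x + expo c x     ≡⟨ ℕP.+-assoc (expo a x) _ _ ⟩
    expo a x + (expo b x + expo c x)   ≡⟨ trans (expo-·M a (b ·M c) x) (cong (expo a x +_) (expo-·M b c x)) ⟨
    expo (a ·M (b ·M c)) x             ∎
    where open ≡-Reasoning

  multilin : Mono n → Mono n
  multilin (e , ē) = mapᵥ clip e , mapᵥ clip ē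

  expo-multilin : ∀ m x → expo (multilin m) x ≡ clip (expo m x)
  expo-multilin m (i , false) = VecP.lookup-map i clip (proj₁ m)
  expo-multilin m (i , true)  = VecP.lookup-map i clip (proj₂ m)

  expo-multilin-·M : ∀ a b x → expo (multilin (a ·M b)) x ≡ clip (expo a x + expo b x)
  expo-multilin-·M a b x = trans (expo-multilin (a ·M b) x) (cong clip (expo-·M a b x))

  twin : Var n → Var n
  twin (i , b) = i , not b

  data Position (x : Var n) : Var n → Set where
    at-self   : Position x x
    at-twin   : Position x (twin x)
    elsewhere : ∀ {y} → proj₁ x ≢ proj₁ y → Position x y

  position : ∀ x y → Position x y
  position (i , b) (j , b′) with i ≟F j
  position (i , false) (i , false) | yes refl = at-self
  position (i , false) (i , true)  | yes refl = at-twin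
  position (i , true)  (i , false) | yes refl = at-twin
  position (i , true)  (i , true)  | yes refl = at-self
  ... | no i≢j = elsewhere i≢j

  δⱽ-twin : ∀ x → δⱽ x (twin x) ≡ 0
  δⱽ-twin (i , false) = δⱽ-≢ (λ ())
  δⱽ-twin (i , true)  = δⱽ-≢ (λ ())

  δⱽ-twinˡ : ∀ x → δⱽ (twin x) x ≡ 0
  δⱽ-twinˡ (i , false) = δⱽ-≢ (λ ())
  δⱽ-twinˡ (i , true)  = δⱽ-≢ (λ ())

  δⱽ-elsewhere : ∀ {x y} → proj₁ x ≢ proj₁ y → δⱽ x y ≡ 0
  δⱽ-elsewhere i≢j = δⱽ-≢ (λ x≡y → i≢j (cong proj₁ x≡y))

  clip-suc : ∀ e k → clip (e + suc k) ≡ 1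
  clip-suc e k rewrite ℕP.+-suc e k = refl

  clip-nonzero : ∀ {e} k → e ≢ 0 → clip (e + k) ≡ 1
  clip-nonzero {zero}  k e≢0 = ⊥-elim (e≢0 refl)
  clip-nonzero {suc e} k e≢0 = refl

  clip-+0 : ∀ e → clip (e + 0) ≡ clip e + 0
  clip-+0 e = trans (cong clip (ℕP.+-identityʳ e)) (sym (ℕP.+-identityʳ _))

  multilin-·-square : ∀ (m a : Mono n) → multilin (m ·M (a ·M a)) ≡ multilin (m ·M a)
  multilin-·-square m a = Mono-ext λ x → begin
    expo (multilin (m ·M (a ·M a))) x         ≡⟨ expo-multilin-·M m (a ·M a) x ⟩
    clip (expo m x + expo (a ·M a) x)         ≡⟨ cong (λ k → clip (expo m x + k)) (expo-·M a a x) ⟩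
    clip (expo m x + (expo a x + expo a x))   ≡⟨ clip-double (expo m x) (expo a x) ⟩
    clip (expo m x + expo a x)                ≡⟨ expo-multilin-·M m a x ⟨
    expo (multilin (m ·M a)) x                ∎
    where
    open ≡-Reasoning
    clip-double : ∀ e k → clip (e + (k + k)) ≡ clip (e + k)
    clip-double e zero    = refl
    clip-double e (suc k) = trans (clip-suc e (k + suc k)) (sym (clip-suc e k))

  multilin-·-oneM : ∀ (m : Mono n) → multilin m ·M oneM ≡ multilin (m ·M oneM)
  multilin-·-oneM m = trans (·M-identityʳ _) (cong multilin (sym (·M-identityʳ m)))

  multilin-·-fresh : ∀ (m : Mono n) x → expo m x ≡ 0 → multilin m ·M varM x ≡ multilin (m ·M varM x)
  multilin-·-fresh m x mₓ≡0 = Mono-ext λ y → begin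
    expo (multilin m ·M varM x) y     ≡⟨ trans (expo-·M (multilin m) (varM x) y) (cong₂ _+_ (expo-multilin m y) (expo-varM x y)) ⟩
    clip (expo m y) + δⱽ x y          ≡⟨ pointwise y (position x y) ⟩
    clip (expo m y + δⱽ x y)          ≡⟨ trans (expo-multilin-·M m (varM x) y) (cong (λ k → clip (expo m y + k)) (expo-varM x y)) ⟨
    expo (multilin (m ·M varM x)) y   ∎
    where
    open ≡-Reasoning
    pointwise : ∀ y → Position x y → clip (expo m y) + δⱽ x y ≡ clip (expo m y + δⱽ x y)
    pointwise y at-self         rewrite mₓ≡0 | δⱽ-refl x = refl
    pointwise y at-twin         rewrite δⱽ-twin x = sym (clip-+0 (expo m y))
    pointwise y (elsewhere i≢j) rewrite δⱽ-elsewhere {x} {y} i≢j = sym (clip-+0 (expo m y))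

  multilin-·-present : ∀ (m : Mono n) x → expo m x ≢ 0 → multilin (m ·M varM x) ≡ multilin m
  multilin-·-present m x mₓ≢0 = Mono-ext λ y → begin
    expo (multilin (m ·M varM x)) y   ≡⟨ trans (expo-multilin-·M m (varM x) y) (cong (λ k → clip (expo m y + k)) (expo-varM x y)) ⟩
    clip (expo m y + δⱽ x y)          ≡⟨ pointwise y (position x y) ⟩
    clip (expo m y)                   ≡⟨ expo-multilin m y ⟨
    expo (multilin m) y               ∎
    where
    open ≡-Reasoning
    pointwise : ∀ y → Position x y → clip (expo m y + δⱽ x y) ≡ clip (expo m y)
    pointwise y at-self         = trans (clip-nonzero (δⱽ x x) mₓ≢0) (sym (trans (cong clip (sym (ℕP.+-identityʳ _))) (clip-nonzero 0 mₓ≢0)))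
    pointwise y at-twin         rewrite δⱽ-twin x = cong clip (ℕP.+-identityʳ _)
    pointwise y (elsewhere i≢j) rewrite δⱽ-elsewhere {x} {y} i≢j = cong clip (ℕP.+-identityʳ _)

  zeroAt : Fin n → Mono n → Mono n
  zeroAt i (e , ē) = (e [ i ]≔ᵥ 0) , (ē [ i ]≔ᵥ 0)

  expo-zeroAt-on : ∀ i m b → expo (zeroAt i m) (i , b) ≡ 0
  expo-zeroAt-on i m false = VecP.lookup∘update i (proj₁ m) 0
  expo-zeroAt-on i m true  = VecP.lookup∘update i (proj₂ m) 0

  expo-zeroAt-off : ∀ {i} m y → i ≢ proj₁ y → expo (zeroAt i m) y ≡ expo m y
  expo-zeroAt-off m (j , false) i≢j = VecP.lookup∘update′ (λ j≡i → i≢j (sym j≡i)) (proj₁ m) 0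
  expo-zeroAt-off m (j , true)  i≢j = VecP.lookup∘update′ (λ j≡i → i≢j (sym j≡i)) (proj₂ m) 0

  bothAt : Fin n → Mono n
  bothAt i = varM (i , false) ·M varM (i , true)

  expo-bothAt : ∀ i y → expo (bothAt i) y ≡ δⱽ (i , false) y + δⱽ (i , true) y
  expo-bothAt i y = trans (expo-·M (varM (i , false)) (varM (i , true)) y) (cong₂ _+_ (expo-varM _ y) (expo-varM _ y))

  expo-bothAt-on : ∀ i b → expo (bothAt i) (i , b) ≡ 1
  expo-bothAt-on i false = trans (expo-bothAt i (i , false)) (cong₂ _+_ (δⱽ-refl (i , false)) (δⱽ-twinˡ (i , false)))
  expo-bothAt-on i true  = trans (expo-bothAt i (i , true)) (cong₂ _+_ (δⱽ-twinˡ (i , true)) (δⱽ-refl (i , true)))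

  expo-bothAt-off : ∀ {i} y → i ≢ proj₁ y → expo (bothAt i) y ≡ 0
  expo-bothAt-off {i} y i≢j =
    trans (expo-bothAt i y) (cong₂ _+_ (δⱽ-elsewhere {i , false} {y} i≢j) (δⱽ-elsewhere {i , true} {y} i≢j))

  multilin-·-twin-present : ∀ (m : Mono n) x → expo m x ≢ 0 →
                            multilin (m ·M varM (twin x)) ≡ multilin (zeroAt (proj₁ x) m) ·M bothAt (proj₁ x)
  multilin-·-twin-present m x@(i , b) mₓ≢0 = Mono-ext λ y → begin
    expo (multilin (m ·M varM (twin x))) y
      ≡⟨ trans (expo-multilin-·M m (varM (twin x)) y) (cong (λ k → clip (expo m y + k)) (expo-varM (twin x) y)) ⟩
    clip (expo m y + δⱽ (twin x) y)
      ≡⟨ pointwise y (position x y) ⟩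
    clip (expo (zeroAt i m) y) + expo (bothAt i) y
      ≡⟨ trans (expo-·M (multilin (zeroAt i m)) (bothAt i) y) (cong (_+ expo (bothAt i) y) (expo-multilin (zeroAt i m) y)) ⟨
    expo (multilin (zeroAt i m) ·M bothAt i) y ∎
    where
    open ≡-Reasoning
    pointwise : ∀ y → Position x y → clip (expo m y + δⱽ (twin x) y) ≡ clip (expo (zeroAt i m) y) + expo (bothAt i) y
    pointwise y at-self
      rewrite expo-zeroAt-on i m b | expo-bothAt-on i b = clip-nonzero (δⱽ (twin x) x) mₓ≢0
    pointwise y at-twin
      rewrite expo-zeroAt-on i m (not b) | expo-bothAt-on i (not b) | δⱽ-refl (twin x) = clip-suc (expo m (twin x)) 0
    pointwise y (elsewhere i≢j)
      rewrite expo-zeroAt-off m y i≢j | expo-bothAt-off y i≢j | δⱽ-elsewhere {twin x} {y} i≢j = clip-+0 (expo m y)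

  residual : Mono n → Mono n → Mono n
  residual (e , ē) (f , f̄) = zipWithᵥ (λ a b → clip a ∸ b) e f , zipWithᵥ (λ a b → clip a ∸ b) ē f̄

  expo-residual : ∀ m X y → expo (residual m X) y ≡ clip (expo m y) ∸ expo X y
  expo-residual m X (i , false) = VecP.lookup-zipWith (λ a b → clip a ∸ b) i (proj₁ m) (proj₁ X)
  expo-residual m X (i , true)  = VecP.lookup-zipWith (λ a b → clip a ∸ b) i (proj₂ m) (proj₂ X)

  multilin-residual : ∀ (m X : Mono n) → (∀ y → expo X y ≤ 1) → multilin (residual m X) ·M X ≡ multilin (m ·M X)
  multilin-residual m X X≤1 = Mono-ext λ y → begin
    expo (multilin (residual m X) ·M X) y
      ≡⟨ expo-·M (multilin (residual m X)) X y ⟩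
    expo (multilin (residual m X)) y + expo X y ≡⟨ cong (_+ expo X y) (trans (expo-multilin (residual m X) y) (cong clip (expo-residual m X y))) ⟩
    clip (clip (expo m y) ∸ expo X y) + expo X y ≡⟨ pointwise (expo m y) (X≤1 y) ⟩
    clip (expo m y + expo X y)
      ≡⟨ expo-multilin-·M m X y ⟨
    expo (multilin (m ·M X)) y ∎
    where
    open ≡-Reasoning
    pointwise : ∀ e {b} → b ≤ 1 → clip (clip e ∸ b) + b ≡ clip (e + b)
    pointwise zero    z≤n       = refl
    pointwise (suc e) z≤n       = refl
    pointwise zero    (s≤s z≤n) = refl
    pointwise (suc e) (s≤s z≤n) = sym (clip-suc (suc e) 0)

prodM : ∀ {n} → List (Var n) → Mono n
prodM []       = oneM
prodM (x ∷ xs) = varM x ·M prodM xs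

consM : ∀ {n} → ℕ → ℕ → Mono n → Mono (suc n)
consM a ā (e , ē) = (a ∷ e) , (ā ∷ ē)

liftV : ∀ {n} → Var n → Var (suc n)
liftV (i , b) = suc i , b

prependIf : ∀ {n} → ℕ → Var n → List (Var n) → List (Var n)
prependIf zero    x xs = xs
prependIf (suc _) x xs = x ∷ xs

varsOf : ∀ {n} → Mono n → List (Var n)
varsOf {zero}  _                   = []
varsOf {suc n} (a ∷ e , ā ∷ ē) =
  prependIf a (zero , false) (prependIf ā (zero , true) (map liftV (varsOf (e , ē))))

length-prependIf : ∀ {n} k (x : Var n) xs → length (prependIf k x xs) ≤ suc (length xs)
length-prependIf zero    x xs = ℕP.n≤1+n _
length-prependIf (suc _) x xs = ℕP.≤-refl

length-varsOf : ∀ {n} (m : Mono n) → length (varsOf m) ≤ n + n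
length-varsOf {zero}  _               = z≤n
length-varsOf {suc n} (a ∷ e , ā ∷ ē) = begin
  length (prependIf a _ (prependIf ā _ rest))   ≤⟨ length-prependIf a _ _ ⟩
  suc (length (prependIf ā _ rest))             ≤⟨ s≤s (length-prependIf ā _ _) ⟩
  suc (suc (length rest))                       ≡⟨ cong (2 +_) (LP.length-map liftV (varsOf (e , ē))) ⟩
  suc (suc (length (varsOf (e , ē))))           ≤⟨ s≤s (s≤s (length-varsOf (e , ē))) ⟩
  suc (suc (n + n))                             ≡⟨ cong suc (ℕP.+-suc n n) ⟨
  suc n + suc n                                 ∎
  where
  open ℕP.≤-Reasoning
  rest = map liftV (varsOf (e , ē))

prodM-lift : ∀ {n} (xs : List (Var n)) → prodM (map liftV xs) ≡ consM 0 0 (prodM xs)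
prodM-lift []               = refl
prodM-lift ((i , false) ∷ xs) rewrite prodM-lift xs = refl
prodM-lift ((i , true)  ∷ xs) rewrite prodM-lift xs = refl

prodM-varsOf : ∀ {n} (m : Mono n) → prodM (varsOf m) ≡ multilin m
prodM-varsOf {zero}  ([] , [])        = refl
prodM-varsOf {suc n} (a ∷ e , ā ∷ ē) =
  trans (prodM-prependIf a ā (varsOf (e , ē))) (cong (consM (clip a) (clip ā)) (prodM-varsOf (e , ē)))
  where
  prodM-prependIf : ∀ a ā xs → prodM (prependIf a (zero , false) (prependIf ā (zero , true) (map liftV xs)))
                                 ≡ consM (clip a) (clip ā) (prodM xs)
  prodM-prependIf zero    zero    xs = prodM-lift xs
  prodM-prependIf zero    (suc _) xs rewrite prodM-lift xs = cong (consM 0 1) (·M-identityˡ (prodM xs))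
  prodM-prependIf (suc _) zero    xs rewrite prodM-lift xs = cong (consM 1 0) (·M-identityˡ (prodM xs))
  prodM-prependIf (suc _) (suc _) xs rewrite prodM-lift xs =
    cong (consM 1 1) (trans (·M-identityˡ (oneM ·M prodM xs)) (·M-identityˡ (prodM xs)))

bit : Bool → ℕ
bit b = if b then 1 else 0

clauseMonomial : ∀ {n} → Clause n → Mono n
clauseMonomial (clause P N) = mapᵥ bit N , mapᵥ bit P

bit≤1 : ∀ b → bit b ≤ 1
bit≤1 false = z≤n
bit≤1 true  = s≤s z≤n

expo-clauseMonomial-≤1 : ∀ {n} (C : Clause n) y → expo (clauseMonomial C) y ≤ 1
expo-clauseMonomial-≤1 (clause P N) (i , false) = subst (_≤ 1) (sym (VecP.lookup-map i bit N)) (bit≤1 (lookup N i))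
expo-clauseMonomial-≤1 (clause P N) (i , true)  = subst (_≤ 1) (sym (VecP.lookup-map i bit P)) (bit≤1 (lookup P i))

cong₃ : ∀ {A B C D : Set} (f : A → B → C → D) {x x′ y y′ z z′} → x ≡ x′ → y ≡ y′ → z ≡ z′ → f x y z ≡ f x′ y′ z′
cong₃ f refl refl refl = refl

module _ {n : ℕ} where

  mapMono : (Mono n → Mono n) → Poly n → Poly n
  mapMono h = map (λ t → proj₁ t , h (proj₂ t))

  coeff-mapMono : ∀ h (p : Poly n) d → coeff (mapMono h p) d ≡ linExt (λ m → δᴹ (h m) d) p
  coeff-mapMono h []            d = refl
  coeff-mapMono h ((c , m) ∷ p) d = trans (coeff-∷ c (h m) (mapMono h p) d) (cong (c *ℚ δᴹ (h m) d +ℚ_) (coeff-mapMono h p d))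

  mapMono-resp-≃ : ∀ h {p q : Poly n} → p ≃ q → mapMono h p ≃ mapMono h q
  mapMono-resp-≃ h {p} {q} p≃q = coeffwise λ d →
    trans (coeff-mapMono h p d) (trans (linExt-resp-≃ (λ m → δᴹ (h m) d) p≃q) (sym (coeff-mapMono h q d)))

  length-mapMono : ∀ h (p : Poly n) → length (mapMono h p) ≡ length p
  length-mapMono h = LP.length-map _

  scale : ℚ → Poly n → Poly n
  scale k = map (λ t → k *ℚ proj₁ t , proj₂ t)

  coeff-scale : ∀ k (p : Poly n) d → coeff (scale k p) d ≡ k *ℚ coeff p d
  coeff-scale k []            d = sym (ℚP.*-zeroʳ k)
  coeff-scale k ((c , m) ∷ p) d = begin
    coeff ((k *ℚ c , m) ∷ scale k p) d
      ≡⟨ coeff-∷ (k *ℚ c) m (scale k p) d ⟩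
    k *ℚ c *ℚ δᴹ m d +ℚ coeff (scale k p) d
      ≡⟨ cong (k *ℚ c *ℚ δᴹ m d +ℚ_) (coeff-scale k p d) ⟩
    k *ℚ c *ℚ δᴹ m d +ℚ k *ℚ coeff p d
      ≡⟨ solve 4 (λ k c δ r → k :* c :* δ :+ k :* r := k :* (c :* δ :+ r)) refl k c (δᴹ m d) (coeff p d) ⟩
    k *ℚ (c *ℚ δᴹ m d +ℚ coeff p d)
      ≡⟨ cong (k *ℚ_) (coeff-∷ c m p d) ⟨
    k *ℚ coeff ((c , m) ∷ p) d ∎
    where
    open ≡-Reasoning
    open ℚSolver.+-*-Solver

  length-scale : ∀ k (p : Poly n) → length (scale k p) ≡ length p
  length-scale k = LP.length-map _

  constP-⊗ : ∀ c (p : Poly n) → constP c ⊗ p ≡ scale c p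
  constP-⊗ c p = trans (LP.++-identityʳ _) (LP.map-cong (λ s → cong (c *ℚ proj₁ s ,_) (·M-identityˡ (proj₂ s))) p)

  varP-⊗ : ∀ x (p : Poly n) → varP x ⊗ p ≡ mapMono (varM x ·M_) p
  varP-⊗ x p = trans (LP.++-identityʳ _) (LP.map-cong (λ s → cong (_, varM x ·M proj₂ s) (ℚP.*-identityˡ (proj₁ s))) p)

  termTimes : ℚ × Mono n → Poly n → Poly n
  termTimes t = map (λ s → proj₁ t *ℚ proj₁ s , proj₂ t ·M proj₂ s)

  termTimes-scale : ∀ c m (r : Poly n) → termTimes (c , m) r ≡ scale c (termTimes (1ℚ , m) r)
  termTimes-scale c m r = trans (LP.map-cong (λ s → cong (_, m ·M proj₂ s) (cong (c *ℚ_) (sym (ℚP.*-identityˡ (proj₁ s))))) r) (LP.map-∘ r)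

  ⊗-congˡ : ∀ {p p′ : Poly n} r → p ≃ p′ → p ⊗ r ≃ p′ ⊗ r
  ⊗-congˡ r = concatMap-resp-≃ λ c m d → trans (cong (λ z → coeff z d) (termTimes-scale c m r)) (coeff-scale c (termTimes (1ℚ , m) r) d)

  length-⊗ : ∀ (p q : Poly n) → length (p ⊗ q) ≡ length p * length q
  length-⊗ []      q = refl
  length-⊗ (t ∷ p) q = trans (LP.length-++ (termTimes t q)) (cong₂ _+_ (LP.length-map _ q) (length-⊗ p q))

  mulMany : List (Var n) → Poly n → Poly n
  mulMany []       p = p
  mulMany (x ∷ xs) p = varP x ⊗ mulMany xs p

  mulMany-mapMono : ∀ xs (p : Poly n) → mulMany xs p ≡ mapMono (prodM xs ·M_) p
  mulMany-mapMono []       p = sym (trans (LP.map-cong (λ s → cong (proj₁ s ,_) (·M-identityˡ (proj₂ s))) p) (LP.map-id p))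
  mulMany-mapMono (x ∷ xs) p = begin
    varP x ⊗ mulMany xs p                              ≡⟨ varP-⊗ x (mulMany xs p) ⟩
    mapMono (varM x ·M_) (mulMany xs p)                ≡⟨ cong (mapMono (varM x ·M_)) (mulMany-mapMono xs p) ⟩
    mapMono (varM x ·M_) (mapMono (prodM xs ·M_) p)    ≡⟨ LP.map-∘ p ⟨
    mapMono (λ m → varM x ·M (prodM xs ·M m)) p        ≡⟨ LP.map-cong (λ s → cong (proj₁ s ,_) (sym (·M-assoc (varM x) (prodM xs) (proj₂ s)))) p ⟩
    mapMono (prodM (x ∷ xs) ·M_) p                     ∎
    where open ≡-Reasoning

  length-mulMany : ∀ xs (p : Poly n) → length (mulMany xs p) ≡ length p
  length-mulMany xs p = trans (cong length (mulMany-mapMono xs p)) (length-mapMono _ p)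

  multilinP : Poly n → Poly n
  multilinP = mapMono multilin

  multilinP-++ : ∀ (p q : Poly n) → multilinP (p ++ q) ≡ multilinP p ++ multilinP q
  multilinP-++ = LP.map-++ _

  coeff-linExt : ∀ (p : Poly n) d → coeff p d ≡ linExt (λ M → δᴹ M d) p
  coeff-linExt []            d = refl
  coeff-linExt ((c , M) ∷ p) d = trans (coeff-∷ c M p d) (cong (c *ℚ δᴹ M d +ℚ_) (coeff-linExt p d))

  scale-resp-≃ : ∀ k {p q : Poly n} → p ≃ q → scale k p ≃ scale k q
  scale-resp-≃ k {p} {q} p≃q = coeffwise λ d →
    trans (coeff-scale k p d) (trans (cong (k *ℚ_) (≃⇒≈P p≃q d)) (sym (coeff-scale k q d)))

  multilin-boolAx : ∀ t i → multilinP (termTimes t (boolAx {n} i)) ≃ zeroP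
  multilin-boolAx (c , m) i = coeffwise λ d → begin
    coeff (multilinP (termTimes (c , m) (boolAx i))) d
      ≡⟨ coeff-linExt (multilinP (termTimes (c , m) (boolAx i))) d ⟩
    c *ℚ 1ℚ *ℚ δᴹ (multilin (m ·M (v ·M v))) d +ℚ (c *ℚ (-ℚ 1ℚ) *ℚ δᴹ (multilin (m ·M v)) d +ℚ 0ℚ)
      ≡⟨ cong (λ M → c *ℚ 1ℚ *ℚ δᴹ M d +ℚ (c *ℚ (-ℚ 1ℚ) *ℚ δᴹ (multilin (m ·M v)) d +ℚ 0ℚ)) (multilin-·-square m v) ⟩
    c *ℚ 1ℚ *ℚ δᴹ (multilin (m ·M v)) d +ℚ (c *ℚ (-ℚ 1ℚ) *ℚ δᴹ (multilin (m ·M v)) d +ℚ 0ℚ)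
      ≡⟨ solve 2 (λ c δ → c :* con 1ℚ :* δ :+ (c :* (:- con 1ℚ) :* δ :+ con 0ℚ) := con 0ℚ) refl c (δᴹ (multilin (m ·M v)) d) ⟩
    0ℚ ∎
    where
    open ≡-Reasoning
    open ℚSolver.+-*-Solver
    v = varM (i , false)

  mulMany-varsOf : ∀ c M (p : Poly n) → constP c ⊗ mulMany (varsOf M) p ≡ scale c (mapMono (multilin M ·M_) p)
  mulMany-varsOf c M p = trans (constP-⊗ c (mulMany (varsOf M) p)) (cong (scale c)
    (trans (mulMany-mapMono (varsOf M) p) (LP.map-cong (λ s → cong (λ K → proj₁ s , K ·M proj₂ s) (prodM-varsOf M)) p)))

  -- Multiplying the clause monomial X by the variables of m that X lacks gives the multilinear form of m·X exactly.
  multilin-clause : ∀ c m (C : Clause n) →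
    constP c ⊗ mulMany (varsOf (residual m (clauseMonomial C))) (clauseMono C) ≡ multilinP (termTimes (c , m) (clauseMono C))
  multilin-clause c m C@(clause P N) = trans (mulMany-varsOf c (residual m X) (clauseMono C))
    (cong (λ M → (c *ℚ 1ℚ , M) ∷ []) (multilin-residual m X (expo-clauseMonomial-≤1 C)))
    where X = clauseMonomial C

  multilin-twinAx-fresh : ∀ c m i → expo m (i , false) ≡ 0 → expo m (i , true) ≡ 0 →
    constP c ⊗ mulMany (varsOf m) (twinAx i) ≡ multilinP (termTimes (c , m) (twinAx {n} i))
  multilin-twinAx-fresh c m i v∉m v̄∉m = trans (mulMany-varsOf c m (twinAx i))
    (cong₃ (λ A B C → (c *ℚ 1ℚ , A) ∷ (c *ℚ 1ℚ , B) ∷ (c *ℚ (-ℚ 1ℚ) , C) ∷ [])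
      (multilin-·-fresh m (i , false) v∉m) (multilin-·-fresh m (i , true) v̄∉m) (multilin-·-oneM m))

  -- v (v + v̄ − 1) − (v² − v) = v v̄
  bothAtCombination : Fin n → Poly n
  bothAtCombination i = (varP (i , false) ⊗ twinAx i) ⊕ (constP (-ℚ 1ℚ) ⊗ boolAx i)

  mapMono-bothAtCombination : ∀ K i → mapMono (K ·M_) (bothAtCombination i) ≃ (1ℚ , K ·M bothAt i) ∷ []
  mapMono-bothAtCombination K i = coeffwise λ d → begin
    coeff (mapMono (K ·M_) (bothAtCombination i)) d
      ≡⟨ coeff-linExt (mapMono (K ·M_) (bothAtCombination i)) d ⟩
    1ℚ *ℚ 1ℚ *ℚ δᴹ (K ·M (v ·M v)) d +ℚ (1ℚ *ℚ 1ℚ *ℚ δᴹ W d +ℚ (1ℚ *ℚ (-ℚ 1ℚ) *ℚ δᴹ (K ·M (v ·M oneM)) d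
      +ℚ ((-ℚ 1ℚ) *ℚ 1ℚ *ℚ δᴹ (K ·M (oneM ·M (v ·M v))) d +ℚ ((-ℚ 1ℚ) *ℚ (-ℚ 1ℚ) *ℚ δᴹ (K ·M (oneM ·M v)) d +ℚ 0ℚ))))
      ≡⟨ cong₂ (λ A B → 1ℚ *ℚ 1ℚ *ℚ δᴹ (K ·M (v ·M v)) d +ℚ (1ℚ *ℚ 1ℚ *ℚ δᴹ W d +ℚ (1ℚ *ℚ (-ℚ 1ℚ) *ℚ δᴹ (K ·M A) d
                  +ℚ ((-ℚ 1ℚ) *ℚ 1ℚ *ℚ δᴹ (K ·M (oneM ·M (v ·M v))) d +ℚ ((-ℚ 1ℚ) *ℚ (-ℚ 1ℚ) *ℚ δᴹ (K ·M B) d +ℚ 0ℚ)))))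
              (·M-identityʳ v) (·M-identityˡ v) ⟩
    1ℚ *ℚ 1ℚ *ℚ δᴹ (K ·M (v ·M v)) d +ℚ (1ℚ *ℚ 1ℚ *ℚ δᴹ W d +ℚ (1ℚ *ℚ (-ℚ 1ℚ) *ℚ δᴹ (K ·M v) d
      +ℚ ((-ℚ 1ℚ) *ℚ 1ℚ *ℚ δᴹ (K ·M (oneM ·M (v ·M v))) d +ℚ ((-ℚ 1ℚ) *ℚ (-ℚ 1ℚ) *ℚ δᴹ (K ·M v) d +ℚ 0ℚ))))
      ≡⟨ cong (λ A → 1ℚ *ℚ 1ℚ *ℚ δᴹ (K ·M (v ·M v)) d +ℚ (1ℚ *ℚ 1ℚ *ℚ δᴹ W d +ℚ (1ℚ *ℚ (-ℚ 1ℚ) *ℚ δᴹ (K ·M v) d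
                  +ℚ ((-ℚ 1ℚ) *ℚ 1ℚ *ℚ δᴹ (K ·M A) d +ℚ ((-ℚ 1ℚ) *ℚ (-ℚ 1ℚ) *ℚ δᴹ (K ·M v) d +ℚ 0ℚ)))))
              (·M-identityˡ (v ·M v)) ⟩
    1ℚ *ℚ 1ℚ *ℚ δᴹ (K ·M (v ·M v)) d +ℚ (1ℚ *ℚ 1ℚ *ℚ δᴹ W d +ℚ (1ℚ *ℚ (-ℚ 1ℚ) *ℚ δᴹ (K ·M v) d
      +ℚ ((-ℚ 1ℚ) *ℚ 1ℚ *ℚ δᴹ (K ·M (v ·M v)) d +ℚ ((-ℚ 1ℚ) *ℚ (-ℚ 1ℚ) *ℚ δᴹ (K ·M v) d +ℚ 0ℚ))))
      ≡⟨ solve 3 (λ y w z → con 1ℚ :* con 1ℚ :* y :+ (con 1ℚ :* con 1ℚ :* w :+ (con 1ℚ :* (:- con 1ℚ) :* z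
                    :+ ((:- con 1ℚ) :* con 1ℚ :* y :+ ((:- con 1ℚ) :* (:- con 1ℚ) :* z :+ con 0ℚ)))) := con 1ℚ :* w :+ con 0ℚ)
                 refl (δᴹ (K ·M (v ·M v)) d) (δᴹ W d) (δᴹ (K ·M v) d) ⟩
    1ℚ *ℚ δᴹ W d +ℚ 0ℚ
      ≡⟨ coeff-linExt ((1ℚ , W) ∷ []) d ⟨
    coeff ((1ℚ , W) ∷ []) d ∎
    where
    open ≡-Reasoning
    open ℚSolver.+-*-Solver
    v = varM (i , false)
    W = K ·M bothAt i

  cancel-first : ∀ c (X Y : Mono n) → (c *ℚ 1ℚ , X) ∷ (c *ℚ 1ℚ , Y) ∷ (c *ℚ (-ℚ 1ℚ) , X) ∷ [] ≃ (c *ℚ 1ℚ , Y) ∷ []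
  cancel-first c X Y = coeffwise λ d → trans (coeff-linExt ((c *ℚ 1ℚ , X) ∷ (c *ℚ 1ℚ , Y) ∷ (c *ℚ (-ℚ 1ℚ) , X) ∷ []) d)
    (trans (solve 3 (λ c x y → c :* con 1ℚ :* x :+ (c :* con 1ℚ :* y :+ (c :* (:- con 1ℚ) :* x :+ con 0ℚ)) := c :* con 1ℚ :* y :+ con 0ℚ)
                    refl c (δᴹ X d) (δᴹ Y d))
           (sym (coeff-linExt ((c *ℚ 1ℚ , Y) ∷ []) d)))
    where open ℚSolver.+-*-Solver

  cancel-second : ∀ c (X Y : Mono n) → (c *ℚ 1ℚ , Y) ∷ (c *ℚ 1ℚ , X) ∷ (c *ℚ (-ℚ 1ℚ) , X) ∷ [] ≃ (c *ℚ 1ℚ , Y) ∷ []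
  cancel-second c X Y = coeffwise λ d → trans (coeff-linExt ((c *ℚ 1ℚ , Y) ∷ (c *ℚ 1ℚ , X) ∷ (c *ℚ (-ℚ 1ℚ) , X) ∷ []) d)
    (trans (solve 3 (λ c x y → c :* con 1ℚ :* y :+ (c :* con 1ℚ :* x :+ (c :* (:- con 1ℚ) :* x :+ con 0ℚ)) := c :* con 1ℚ :* y :+ con 0ℚ)
                    refl c (δᴹ X d) (δᴹ Y d))
           (sym (coeff-linExt ((c *ℚ 1ℚ , Y) ∷ []) d)))
    where open ℚSolver.+-*-Solver

  multilin-twinAx-present : ∀ c m i b → expo m (i , b) ≢ 0 →
    multilinP (termTimes (c , m) (twinAx {n} i)) ≃ (c *ℚ 1ℚ , multilin (zeroAt i m) ·M bothAt i) ∷ []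
  multilin-twinAx-present c m i false m∋v = ≃-trans
    (≡⇒≃ (cong₃ (λ A B C → (c *ℚ 1ℚ , A) ∷ (c *ℚ 1ℚ , B) ∷ (c *ℚ (-ℚ 1ℚ) , C) ∷ [])
      (multilin-·-present m (i , false) m∋v) (multilin-·-twin-present m (i , false) m∋v) (cong multilin (·M-identityʳ m))))
    (cancel-first c (multilin m) _)
  multilin-twinAx-present c m i true m∋v̄ = ≃-trans
    (≡⇒≃ (cong₃ (λ A B C → (c *ℚ 1ℚ , A) ∷ (c *ℚ 1ℚ , B) ∷ (c *ℚ (-ℚ 1ℚ) , C) ∷ [])
      (multilin-·-twin-present m (i , true) m∋v̄) (multilin-·-present m (i , true) m∋v̄) (cong multilin (·M-identityʳ m))))
    (cancel-second c (multilin m) _)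

  multilin-twinAx-overlap : ∀ c m i b → expo m (i , b) ≢ 0 →
    constP c ⊗ mulMany (varsOf (zeroAt i m)) (bothAtCombination i) ≃ multilinP (termTimes (c , m) (twinAx {n} i))
  multilin-twinAx-overlap c m i b m∋x = begin
    constP c ⊗ mulMany (varsOf (zeroAt i m)) (bothAtCombination i)   ≡⟨ mulMany-varsOf c (zeroAt i m) (bothAtCombination i) ⟩
    scale c (mapMono (K ·M_) (bothAtCombination i))                  ≈⟨ scale-resp-≃ c (mapMono-bothAtCombination K i) ⟩
    (c *ℚ 1ℚ , K ·M bothAt i) ∷ []                                    ≈⟨ multilin-twinAx-present c m i b m∋x ⟨
    multilinP (termTimes (c , m) (twinAx i))                         ∎
    where
    open SetoidReasoning ≃-setoid
    K = multilin (zeroAt i m)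

-- Counting monomials

∈-++-drop : ∀ {A : Set} {y x : A} xs ys → y ∈ xs ++ x ∷ ys → y ≢ x → y ∈ xs ++ ys
∈-++-drop []       ys (here refl) y≢x = ⊥-elim (y≢x refl)
∈-++-drop []       ys (there y∈)  _   = y∈
∈-++-drop (z ∷ xs) ys (here refl) _   = here refl
∈-++-drop (z ∷ xs) ys (there y∈)  y≢x = there (∈-++-drop xs ys y∈ y≢x)

length-≤-Unique : ∀ {A : Set} {xs ys : List A} → Unique xs → (∀ {x} → x ∈ xs → x ∈ ys) → length xs ≤ length ys
length-≤-Unique {xs = []}     _            _    = z≤n
length-≤-Unique {xs = x ∷ xs} (x∉xs ∷ xs!) xs⊆ys with ∈-∃++ (xs⊆ys (here refl))
... | ys₁ , ys₂ , refl = begin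
  suc (length xs)
    ≤⟨ s≤s (length-≤-Unique xs! (λ y∈ → ∈-++-drop ys₁ ys₂ (xs⊆ys (there y∈)) (λ { refl → AllP.All¬⇒¬Any x∉xs y∈ }))) ⟩
  suc (length (ys₁ ++ ys₂))
    ≡⟨ cong suc (LP.length-++ ys₁) ⟩
  suc (length ys₁ + length ys₂) ≡⟨ ℕP.+-suc (length ys₁) (length ys₂) ⟨
  length ys₁ + suc (length ys₂) ≡⟨ LP.length-++ ys₁ ⟨
  length (ys₁ ++ x ∷ ys₂) ∎
  where open ℕP.≤-Reasoning

module _ {n : ℕ} where

  coeff≢0⇒∈monos : ∀ (q : Poly n) {m} → coeff q m ≢ 0ℚ → m ∈ monos q
  coeff≢0⇒∈monos q {m} q[m]≢0 with DecMembership._∈?_ _≟M_ m (monos q)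
  ... | yes m∈ = m∈
  ... | no  m∉ = ⊥-elim (q[m]≢0 (coeff-∉ q m∉))

  support : Poly n → List (Mono n)
  support p = deduplicate _≟M_ (filter (λ m → ¬? (coeff p m ℚP.≟ 0ℚ)) (monos p))

  support-! : ∀ p → Unique (support p)
  support-! p = deduplicate-! _≟M_ _

  ∈support⇒coeff≢0 : ∀ p {m} → m ∈ support p → coeff p m ≢ 0ℚ
  ∈support⇒coeff≢0 p m∈ = proj₂ (∈-filter⁻ (λ m → ¬? (coeff p m ℚP.≟ 0ℚ)) {xs = monos p} (∈-deduplicate⁻ _≟M_ _ m∈))

  coeff≢0⇒∈support : ∀ p {m} → coeff p m ≢ 0ℚ → m ∈ support p
  coeff≢0⇒∈support p {m} p[m]≢0 = ∈-deduplicate⁺ _≟M_ (∈-filter⁺ (λ m → ¬? (coeff p m ℚP.≟ 0ℚ)) (coeff≢0⇒∈monos p p[m]≢0) p[m]≢0)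

  nmon≤length : ∀ {p q : Poly n} → p ≃ q → nmon p ≤ length q
  nmon≤length {p} {q} p≃q = ℕP.≤-trans
    (length-≤-Unique (support-! p) (λ m∈ → coeff≢0⇒∈monos q (λ q[m]≡0 → ∈support⇒coeff≢0 p m∈ (trans (≃⇒≈P p≃q _) q[m]≡0))))
    (ℕP.≤-reflexive (LP.length-map proj₂ q))

  normalise : Poly n → Poly n
  normalise q = map (λ m → coeff q m , m) (support q)

  length-normalise : ∀ q → length (normalise q) ≡ nmon q
  length-normalise q = LP.length-map _ (support q)

  normalise-≃ : ∀ q → normalise q ≃ q
  normalise-≃ q = coeffwise λ d → trans (coeff-normalise (support q) d) (by-membership d)
    where
    coeff-normalise : ∀ D d → coeff (map (λ m → coeff q m , m) D) d ≡ sumOver D (λ m → δᴹ d m *ℚ coeff q m)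
    coeff-normalise []      d = refl
    coeff-normalise (m ∷ D) d = trans (coeff-∷ (coeff q m) m _ d)
      (cong₂ _+ℚ_ (trans (ℚP.*-comm (coeff q m) (δᴹ m d)) (cong (_*ℚ coeff q m) (δᴹ-sym m d))) (coeff-normalise D d))
    by-membership : ∀ d → sumOver (support q) (λ m → δᴹ d m *ℚ coeff q m) ≡ coeff q d
    by-membership d with DecMembership._∈?_ _≟M_ d (support q)
    ... | yes d∈ = sumOver-δᴹ (support q) (coeff q) (support-! q) d∈
    ... | no  d∉ with coeff q d ℚP.≟ 0ℚ
    ...   | yes q[d]≡0 = trans (sumOver-δᴹ-∉ (support q) (coeff q) d∉) (sym q[d]≡0)
    ...   | no  q[d]≢0 = ⊥-elim (d∉ (coeff≢0⇒∈support q q[d]≢0))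

  normalise-supported : ∀ q → All (λ t → coeff q (proj₂ t) ≢ 0ℚ) (normalise q)
  normalise-supported q = tabulate λ t∈ → supported t∈
    where
    supported : ∀ {t} → t ∈ normalise q → coeff q (proj₂ t) ≢ 0ℚ
    supported t∈ with ∈-map⁻ (λ m → coeff q m , m) t∈
    ... | m , m∈ , refl = ∈support⇒coeff≢0 q m∈

-- Restriction

module _ {n : ℕ} where

  restrict-∷ : ∀ t (p : Poly n) u b → restrict (t ∷ p) u b ≡ restrict (t ∷ []) u b ++ restrict p u b
  restrict-∷ (c , (e , ē)) p u b with lookup e u
  ... | zero  = refl
  ... | suc _ with b
  ...   | true  = refl
  ...   | false = refl

  restrict-concatMap : ∀ (p : Poly n) u b → restrict p u b ≡ concatMap (λ t → restrict (t ∷ []) u b) p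
  restrict-concatMap []      u b = refl
  restrict-concatMap (t ∷ p) u b = trans (restrict-∷ t p u b) (cong (restrict (t ∷ []) u b ++_) (restrict-concatMap p u b))

  restrict-termwiseLinear : ∀ u b → TermwiseLinear (λ t → restrict {n} (t ∷ []) u b)
  restrict-termwiseLinear u b c (e , ē) d with lookup e u
  ... | zero  = trans (coeff-[] c (e , ē) d) (cong (c *ℚ_) (sym (trans (coeff-[] 1ℚ (e , ē) d) (ℚP.*-identityˡ _))))
  ... | suc _ with b
  ...   | true  = trans (coeff-[] c (e [ u ]≔ᵥ 0 , ē) d) (cong (c *ℚ_) (sym (trans (coeff-[] 1ℚ (e [ u ]≔ᵥ 0 , ē) d) (ℚP.*-identityˡ _))))
  ...   | false = sym (ℚP.*-zeroʳ c)

  restrict-resp-≃ : ∀ u b {p q : Poly n} → p ≃ q → restrict p u b ≃ restrict q u b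
  restrict-resp-≃ u b {p} {q} p≃q rewrite restrict-concatMap p u b | restrict-concatMap q u b =
    concatMap-resp-≃ (restrict-termwiseLinear u b) p≃q

  length-restrict : ∀ (p : Poly n) u b → length (restrict p u b) ≤ length p
  length-restrict []                  u b = z≤n
  length-restrict ((c , (e , ē)) ∷ p) u b with lookup e u
  ... | zero  = s≤s (length-restrict p u b)
  ... | suc _ with b
  ...   | true  = s≤s (length-restrict p u true)
  ...   | false = ℕP.m≤n⇒m≤1+n (length-restrict p u false)

  restrict-++ : ∀ (p q : Poly n) u b → restrict (p ++ q) u b ≡ restrict p u b ++ restrict q u b
  restrict-++ []      q u b = refl
  restrict-++ (t ∷ p) q u b = begin
    restrict (t ∷ p ++ q) u b
      ≡⟨ restrict-∷ t (p ++ q) u b ⟩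
    restrict (t ∷ []) u b ++ restrict (p ++ q) u b
      ≡⟨ cong (restrict (t ∷ []) u b ++_) (restrict-++ p q u b) ⟩
    restrict (t ∷ []) u b ++ restrict p u b ++ restrict q u b ≡⟨ LP.++-assoc (restrict (t ∷ []) u b) _ _ ⟨
    (restrict (t ∷ []) u b ++ restrict p u b) ++ restrict q u b ≡⟨ cong (_++ restrict q u b) (restrict-∷ t p u b) ⟨
    restrict (t ∷ p) u b ++ restrict q u b ∎
    where open ≡-Reasoning

  restrict-free : ∀ (p : Poly n) u b → All (λ t → expo (proj₂ t) (u , false) ≡ 0) p → restrict p u b ≡ p
  restrict-free []                  u b []           = refl
  restrict-free ((c , (e , ē)) ∷ p) u b (e[u]≡0 ∷ ps) rewrite e[u]≡0 = cong (_ ∷_) (restrict-free p u b ps)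

  restrict-single-free : ∀ c (m : Mono n) u b → expo m (u , false) ≡ 0 → restrict ((c , m) ∷ []) u b ≡ (c , m) ∷ []
  restrict-single-free c m u b mᵤ≡0 = restrict-free ((c , m) ∷ []) u b (mᵤ≡0 ∷ [])

  restrict-single-true : ∀ c (m : Mono n) u k → expo m (u , false) ≡ suc k →
                         restrict ((c , m) ∷ []) u true ≡ (c , (proj₁ m [ u ]≔ᵥ 0 , proj₂ m)) ∷ []
  restrict-single-true c m u k mᵤ≡1+k rewrite mᵤ≡1+k = refl

  restrict-single-false : ∀ c (m : Mono n) u k → expo m (u , false) ≡ suc k → restrict ((c , m) ∷ []) u false ≡ []
  restrict-single-false c m u k mᵤ≡1+k rewrite mᵤ≡1+k = refl

-- The target polynomial and ∀-reduction

two half : ℚ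
two  = ℤ.+ 2 / 1
half = ℤ.+ 1 / 2

module _ {n : ℕ} where

  AllMonos : (Mono n → Set) → Poly n → Set
  AllMonos P = All (λ t → P (proj₂ t))

  negP : Poly n → Poly n
  negP = scale (-ℚ 1ℚ)

  target : (Fin n → Poly n) → List (Fin n) → Poly n
  target q []       = constP (-ℚ 1ℚ)
  target q (u ∷ us) = negP (q u ⊗ oneMinus2 u) ⊕ target q us

  Absent : Mono n → Fin n → Set
  Absent m i = (expo m (i , false) ≡ 0) × (expo m (i , true) ≡ 0)

  record ScopedBeforeᴹ (k : Fin n) (m : Mono n) : Set where
    constructor scopedBefore
    field vanishes-from : ∀ i → k ≤F i → Absent m i

  record ScopedExceptᴹ (u : Fin n) (m : Mono n) : Set where
    constructor scopedExcept
    field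
      twin-vanishes  : expo m (u , true) ≡ 0
      vanishes-after : ∀ i → u <F i → Absent m i

  open ScopedBeforeᴹ
  open ScopedExceptᴹ

  zero+zero : ∀ {a b : ℕ} → a ≡ 0 → b ≡ 0 → a + b ≡ 0
  zero+zero refl refl = refl

  expo-·M-zero : ∀ (a b : Mono n) x → expo a x ≡ 0 → expo b x ≡ 0 → expo (a ·M b) x ≡ 0
  expo-·M-zero a b x aₓ≡0 bₓ≡0 = trans (expo-·M a b x) (zero+zero aₓ≡0 bₓ≡0)

  Absent-·M : ∀ (a b : Mono n) {i} → Absent a i → Absent b i → Absent (a ·M b) i
  Absent-·M a b {i} (a₀ , a₁) (b₀ , b₁) = expo-·M-zero a b (i , false) a₀ b₀ , expo-·M-zero a b (i , true) a₁ b₁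

  ScopedBeforeᴹ-·M : ∀ {k a b} → ScopedBeforeᴹ k a → ScopedBeforeᴹ k b → ScopedBeforeᴹ k (a ·M b)
  ScopedBeforeᴹ-·M {a = a} {b} (scopedBefore sa) (scopedBefore sb) = scopedBefore λ i k≤i → Absent-·M a b (sa i k≤i) (sb i k≤i)

  ScopedBeforeᴹ-oneM : ∀ {k} → ScopedBeforeᴹ k oneM
  ScopedBeforeᴹ-oneM = scopedBefore λ i _ → expo-oneM (i , false) , expo-oneM (i , true)

  ScopedBeforeᴹ-varM : ∀ {k u} b → u <F k → ScopedBeforeᴹ k (varM (u , b))
  ScopedBeforeᴹ-varM {k} {u} b u<k = scopedBefore λ i k≤i → vanish i k≤i false , vanish i k≤i true
    where
    vanish : ∀ i → k ≤F i → ∀ b′ → expo (varM (u , b)) (i , b′) ≡ 0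
    vanish i k≤i b′ = trans (expo-varM (u , b) (i , b′)) (δⱽ-elsewhere {x = u , b} {y = i , b′} u≢i)
      where
      u≢i : u ≢ i
      u≢i u≡i = ℕP.<-irrefl (cong Data.Fin.toℕ u≡i) (ℕP.<-≤-trans u<k k≤i)

  ScopedBeforeᴹ-weaken : ∀ {u k m} → u ≤F k → ScopedBeforeᴹ u m → ScopedBeforeᴹ k m
  ScopedBeforeᴹ-weaken u≤k (scopedBefore s) = scopedBefore λ i k≤i → s i (ℕP.≤-trans u≤k k≤i)

  ScopedExceptᴹ-·M : ∀ {u a b} → ScopedExceptᴹ u a → ScopedExceptᴹ u b → ScopedExceptᴹ u (a ·M b)
  ScopedExceptᴹ-·M {u} {a} {b} (scopedExcept aū≡0 sa) (scopedExcept bū≡0 sb) =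
    scopedExcept (expo-·M-zero a b (u , true) aū≡0 bū≡0) λ i u<i → Absent-·M a b (sa i u<i) (sb i u<i)

  ScopedBeforeᴹ⇒ScopedExceptᴹ : ∀ {u m} → ScopedBeforeᴹ u m → ScopedExceptᴹ u m
  ScopedBeforeᴹ⇒ScopedExceptᴹ {u} (scopedBefore s) = scopedExcept (proj₂ (s u ℕP.≤-refl)) λ i u<i → s i (ℕP.<⇒≤ u<i)

  ScopedExceptᴹ-varM : ∀ u → ScopedExceptᴹ u (varM (u , false))
  ScopedExceptᴹ-varM u = scopedExcept (trans (expo-varM (u , false) (u , true)) (δⱽ-twin (u , false)))
    λ i u<i → vanishes-from (ScopedBeforeᴹ-varM {k = i} false u<i) i ℕP.≤-refl

  AllMonos-negP-⊗-oneMinus2 : ∀ {P : Mono n → Set} u → (∀ {a b} → P a → P b → P (a ·M b)) → P oneM → P (varM (u , false)) →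
                              ∀ {L} → AllMonos P L → AllMonos P (negP (L ⊗ oneMinus2 u))
  AllMonos-negP-⊗-oneMinus2 u P-·M P-1 P-u []         = []
  AllMonos-negP-⊗-oneMinus2 u P-·M P-1 P-u (Pm ∷ PL) = P-·M Pm P-1 ∷ P-·M Pm P-u ∷ AllMonos-negP-⊗-oneMinus2 u P-·M P-1 P-u PL

  Scoped : (Fin n → Poly n) → Fin n → Set
  Scoped q u = AllMonos (ScopedBeforeᴹ u) (q u)

  target-scopedBefore : ∀ q k {us} → All (_<F k) us → All (Scoped q) us → AllMonos (ScopedBeforeᴹ k) (target q us)
  target-scopedBefore q k []             []         = ScopedBeforeᴹ-oneM ∷ []
  target-scopedBefore q k (u<k ∷ us<k) (qᵤ ∷ qs) = AllP.++⁺
    (AllMonos-negP-⊗-oneMinus2 _ ScopedBeforeᴹ-·M ScopedBeforeᴹ-oneM (ScopedBeforeᴹ-varM false u<k)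
      (mapᴬ (ScopedBeforeᴹ-weaken (ℕP.<⇒≤ u<k)) qᵤ))
    (target-scopedBefore q k us<k qs)

  target-scopedExcept : ∀ q u {us} → All (_<F u) us → All (Scoped q) (u ∷ us) → AllMonos (ScopedExceptᴹ u) (target q (u ∷ us))
  target-scopedExcept q u us<u (qᵤ ∷ qs) = AllP.++⁺
    (AllMonos-negP-⊗-oneMinus2 u ScopedExceptᴹ-·M (ScopedBeforeᴹ⇒ScopedExceptᴹ ScopedBeforeᴹ-oneM) (ScopedExceptᴹ-varM u)
      (mapᴬ ScopedBeforeᴹ⇒ScopedExceptᴹ qᵤ))
    (mapᴬ ScopedBeforeᴹ⇒ScopedExceptᴹ (target-scopedBefore q u us<u qs))

  AllMonos-coeff≢0 : ∀ {P : Mono n → Set} {p : Poly n} → AllMonos P p → ∀ {m} → coeff p m ≢ 0ℚ → P m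
  AllMonos-coeff≢0 {p = p} Pp p[m]≢0 = lookupᴬ (AllP.map⁺ Pp) (coeff≢0⇒∈monos p p[m]≢0)

  target-ScopedExcept : ∀ q u {us a} → a ≃ target q (u ∷ us) → All (_<F u) us → All (Scoped q) (u ∷ us) → ScopedExcept a u
  target-ScopedExcept q u a≃t us<u qs m a[m]≢0 = twin-vanishes s , vanishes-after s
    where s = AllMonos-coeff≢0 (target-scopedExcept q u us<u qs) (λ t[m]≡0 → a[m]≢0 (trans (≃⇒≈P a≃t m) t[m]≡0))

  expo-·M-varM-self : ∀ (m : Mono n) u → expo m (u , false) ≡ 0 → expo (m ·M varM (u , false)) (u , false) ≡ 1
  expo-·M-varM-self m u mᵤ≡0 = trans (expo-·M m (varM (u , false)) (u , false))
                                      (cong₂ _+_ mᵤ≡0 (trans (expo-varM (u , false) (u , false)) (δⱽ-refl (u , false))))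

  clear-u : ∀ (m : Mono n) u → expo m (u , false) ≡ 0 →
            (proj₁ (m ·M varM (u , false)) [ u ]≔ᵥ 0 , proj₂ (m ·M varM (u , false))) ≡ m
  clear-u m u mᵤ≡0 = Mono-ext pointwise
    where
    mu = m ·M varM (u , false)
    off : ∀ y → u ≢ proj₁ y → expo mu y ≡ expo m y
    off y u≢i = trans (expo-·M m (varM (u , false)) y)
                      (trans (cong (expo m y +_) (trans (expo-varM (u , false) y) (δⱽ-elsewhere {x = u , false} {y = y} u≢i))) (ℕP.+-identityʳ _))
    pointwise : ∀ y → expo (proj₁ mu [ u ]≔ᵥ 0 , proj₂ mu) y ≡ expo m y
    pointwise (i , true)  = trans (expo-·M m (varM (u , false)) (i , true))
      (trans (cong (expo m (i , true) +_) (trans (expo-varM (u , false) (i , true)) (δⱽ-≢ (λ ())))) (ℕP.+-identityʳ _))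
    pointwise (i , false) with u ≟F i
    ... | yes refl = trans (VecP.lookup∘update u (proj₁ mu) 0) (sym mᵤ≡0)
    ... | no  u≢i  = trans (VecP.lookup∘update′ (λ i≡u → u≢i (sym i≡u)) (proj₁ mu) 0) (off (i , false) u≢i)

  restrict-oneMinus2-cancels : ∀ u {L} → AllMonos (ScopedBeforeᴹ u) L → ∀ d →
    coeff (restrict (negP (L ⊗ oneMinus2 u)) u false) d +ℚ coeff (restrict (negP (L ⊗ oneMinus2 u)) u true) d ≡ 0ℚ
  restrict-oneMinus2-cancels u []                             d = refl
  restrict-oneMinus2-cancels u {(c , m) ∷ L} (scopedBefore s ∷ sL) d = begin
    coeff (restrict N u false) d +ℚ coeff (restrict N u true) d
      ≡⟨ cong₂ (λ p q → coeff p d +ℚ coeff q d) (restrict-N false) (restrict-N true) ⟩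
    coeff ((a , m ·M oneM) ∷ [] ++ [] ++ R₀) d +ℚ coeff ((a , m ·M oneM) ∷ [] ++ (b , m ·M oneM) ∷ [] ++ R₁) d
      ≡⟨ cong₂ _+ℚ_ (coeff-∷ a (m ·M oneM) R₀ d) (trans (coeff-∷ a (m ·M oneM) _ d) (cong (a *ℚ δ +ℚ_) (coeff-∷ b (m ·M oneM) R₁ d))) ⟩
    a *ℚ δ +ℚ coeff R₀ d +ℚ (a *ℚ δ +ℚ (b *ℚ δ +ℚ coeff R₁ d))
      ≡⟨ solve 4 (λ c δ r₀ r₁ → (:- con 1ℚ) :* (c :* con 1ℚ) :* δ :+ r₀ :+ ((:- con 1ℚ) :* (c :* con 1ℚ) :* δ
                     :+ ((:- con 1ℚ) :* (c :* (:- con two)) :* δ :+ r₁)) := r₀ :+ r₁) refl c δ (coeff R₀ d) (coeff R₁ d) ⟩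
    coeff R₀ d +ℚ coeff R₁ d
      ≡⟨ restrict-oneMinus2-cancels u sL d ⟩
    0ℚ ∎
    where
    open ≡-Reasoning
    open ℚSolver.+-*-Solver
    v = varM (u , false)
    a = -ℚ 1ℚ *ℚ (c *ℚ 1ℚ)
    b = -ℚ 1ℚ *ℚ (c *ℚ (-ℚ two))
    rest = negP (L ⊗ oneMinus2 u)
    N = (a , m ·M oneM) ∷ (b , m ·M v) ∷ rest
    R₀ = restrict rest u false
    R₁ = restrict rest u true
    δ = δᴹ (m ·M oneM) d
    mᵤ≡0 : expo m (u , false) ≡ 0
    mᵤ≡0 = proj₁ (s u ℕP.≤-refl)
    m1ᵤ≡0 : expo (m ·M oneM) (u , false) ≡ 0
    m1ᵤ≡0 = expo-·M-zero m oneM (u , false) mᵤ≡0 (expo-oneM (u , false))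
    restrict-N-split : ∀ β → restrict N u β ≡ restrict ((a , m ·M oneM) ∷ []) u β ++ restrict ((b , m ·M v) ∷ []) u β ++ restrict rest u β
    restrict-N-split β = trans (restrict-∷ (a , m ·M oneM) _ u β) (cong (restrict ((a , m ·M oneM) ∷ []) u β ++_) (restrict-∷ (b , m ·M v) rest u β))
    restrict-N : ∀ β → restrict N u β ≡ (a , m ·M oneM) ∷ [] ++ (if β then (b , m ·M oneM) ∷ [] else []) ++ restrict rest u β
    restrict-N false = trans (restrict-N-split false) (cong₂ (λ p q → p ++ q ++ R₀)
      (restrict-single-free a (m ·M oneM) u false m1ᵤ≡0) (restrict-single-false b (m ·M v) u 0 (expo-·M-varM-self m u mᵤ≡0)))
    restrict-N true = trans (restrict-N-split true) (cong₂ (λ p q → p ++ q ++ R₁)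
      (restrict-single-free a (m ·M oneM) u true m1ᵤ≡0)
      (trans (restrict-single-true b (m ·M v) u 0 (expo-·M-varM-self m u mᵤ≡0))
             (cong (λ M → (b , M) ∷ []) (trans (clear-u m u mᵤ≡0) (sym (·M-identityʳ m))))))

  -- The u-free part of the target survives both restrictions, while the two restrictions of −q_u(1 − 2u) are −q_u and q_u.
  ∀-reduce-target : ∀ q u {us a} → a ≃ target q (u ∷ us) → All (_<F u) us → All (Scoped q) (u ∷ us) →
                    constP half ⊗ (restrict a u false ⊕ restrict a u true) ≃ target q us
  ∀-reduce-target q u {us} {a} a≃t us<u (qᵤ ∷ qs) = coeffwise coeff-reduced
    where
    N = negP (q u ⊗ oneMinus2 u)
    rest-u-free : All (λ t → expo (proj₂ t) (u , false) ≡ 0) (target q us)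
    rest-u-free = mapᴬ (λ s → proj₁ (vanishes-from s u ℕP.≤-refl)) (target-scopedBefore q u us<u qs)
    restrict-a : ∀ β → restrict a u β ≃ restrict N u β ⊕ target q us
    restrict-a β = ≃-trans (restrict-resp-≃ u β a≃t) (≡⇒≃ (trans (restrict-++ N (target q us) u β)
                     (cong (restrict N u β ++_) (restrict-free (target q us) u β rest-u-free))))
    coeff-reduced : ∀ d → coeff (constP half ⊗ (restrict a u false ⊕ restrict a u true)) d ≡ coeff (target q us) d
    coeff-reduced d = begin
      coeff (constP half ⊗ (restrict a u false ⊕ restrict a u true)) d
        ≡⟨ cong (λ p → coeff p d) (constP-⊗ half (restrict a u false ⊕ restrict a u true)) ⟩
      coeff (scale half (restrict a u false ⊕ restrict a u true)) d
        ≡⟨ trans (coeff-scale half (restrict a u false ⊕ restrict a u true) d) (cong (half *ℚ_) (coeff-++ (restrict a u false) (restrict a u true) d)) ⟩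
      half *ℚ (coeff (restrict a u false) d +ℚ coeff (restrict a u true) d)
        ≡⟨ cong₂ (λ x y → half *ℚ (x +ℚ y)) (coeff-restrict-a false) (coeff-restrict-a true) ⟩
      half *ℚ ((x₀ +ℚ t) +ℚ (x₁ +ℚ t))
        ≡⟨ solve 3 (λ x₀ x₁ t → con half :* ((x₀ :+ t) :+ (x₁ :+ t)) := con half :* (x₀ :+ x₁) :+ t) refl x₀ x₁ t ⟩
      half *ℚ (x₀ +ℚ x₁) +ℚ t
        ≡⟨ cong (λ z → half *ℚ z +ℚ t) (restrict-oneMinus2-cancels u qᵤ d) ⟩
      half *ℚ 0ℚ +ℚ t
        ≡⟨ trans (cong (_+ℚ t) (ℚP.*-zeroʳ half)) (ℚP.+-identityˡ t) ⟩
      t ∎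
      where
      open ≡-Reasoning
      open ℚSolver.+-*-Solver
      x₀ = coeff (restrict N u false) d
      x₁ = coeff (restrict N u true) d
      t  = coeff (target q us) d
      coeff-restrict-a : ∀ β → coeff (restrict a u β) d ≡ coeff (restrict N u β) d +ℚ t
      coeff-restrict-a β = trans (≃⇒≈P (restrict-a β) d) (coeff-++ (restrict N u β) (target q us) d)

  negate-target-[] : ∀ q {a} → a ≃ target q [] → constP (-ℚ 1ℚ) ⊗ a ≃ constP {n} 1ℚ
  negate-target-[] q {a} a≃t = coeffwise λ d → begin
    coeff (constP (-ℚ 1ℚ) ⊗ a) d          ≡⟨ cong (λ p → coeff p d) (constP-⊗ (-ℚ 1ℚ) a) ⟩
    coeff (scale (-ℚ 1ℚ) a) d             ≡⟨ coeff-scale (-ℚ 1ℚ) a d ⟩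
    -ℚ 1ℚ *ℚ coeff a d                    ≡⟨ cong (-ℚ 1ℚ *ℚ_) (trans (≃⇒≈P a≃t d) (coeff-[] (-ℚ 1ℚ) oneM d)) ⟩
    -ℚ 1ℚ *ℚ (-ℚ 1ℚ *ℚ δᴹ oneM d)         ≡⟨ solve 1 (λ δ → :- con 1ℚ :* (:- con 1ℚ :* δ) := con 1ℚ :* δ) refl (δᴹ oneM d) ⟩
    1ℚ *ℚ δᴹ oneM d                       ≡⟨ coeff-[] 1ℚ oneM d ⟨
    coeff (constP 1ℚ) d                   ∎
    where
    open ≡-Reasoning
    open ℚSolver.+-*-Solver

-- Multilinearising a QNS identity

module _ {n : ℕ} where

  ⊕-comm : ∀ (p q : Poly n) → p ⊕ q ≃ q ⊕ p
  ⊕-comm p q = coeffwise λ d → trans (coeff-++ p q d) (trans (ℚP.+-comm (coeff p d) (coeff q d)) (sym (coeff-++ q p d)))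

  sumP-++ : ∀ (ps qs : List (Poly n)) → sumP (ps ++ qs) ≡ sumP ps ⊕ sumP qs
  sumP-++ []       qs = refl
  sumP-++ (p ∷ ps) qs = trans (cong (p ⊕_) (sumP-++ ps qs)) (sym (LP.++-assoc p (sumP ps) (sumP qs)))

  sumP-reverse : ∀ (ps : List (Poly n)) → sumP (reverse ps) ≃ sumP ps
  sumP-reverse []       = ≃-refl
  sumP-reverse (p ∷ ps) = begin
    sumP (reverse (p ∷ ps))        ≡⟨ cong sumP (LP.unfold-reverse p ps) ⟩
    sumP (reverse ps ++ p ∷ [])    ≡⟨ sumP-++ (reverse ps) (p ∷ []) ⟩
    sumP (reverse ps) ⊕ (p ⊕ [])   ≈⟨ ⊕-cong (sumP-reverse ps) (≡⇒≃ (LP.++-identityʳ p)) ⟩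
    sumP ps ⊕ p                    ≈⟨ ⊕-comm (sumP ps) p ⟩
    p ⊕ sumP ps                    ∎
    where open SetoidReasoning ≃-setoid

  sumP-map-resp : ∀ {A : Set} {P : A → Set} {f g : A → Poly n} → (∀ {x} → P x → f x ≃ g x) →
                  ∀ {xs} → All P xs → sumP (map f xs) ≃ sumP (map g xs)
  sumP-map-resp f≃g []         = ≃-refl
  sumP-map-resp f≃g (px ∷ pxs) = ⊕-cong (f≃g px) (sumP-map-resp f≃g pxs)

  multilinP-sumP : ∀ (ps : List (Poly n)) → multilinP (sumP ps) ≡ sumP (map multilinP ps)
  multilinP-sumP []       = refl
  multilinP-sumP (p ∷ ps) = trans (multilinP-++ p (sumP ps)) (cong (multilinP p ++_) (multilinP-sumP ps))

  negP-⊕ : ∀ (p q : Poly n) → negP (p ⊕ q) ≡ negP p ⊕ negP q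
  negP-⊕ = LP.map-++ _

  ⊕≃0⇒≃negP : ∀ {p q : Poly n} → p ⊕ q ≃ zeroP → p ≃ negP q
  ⊕≃0⇒≃negP {p} {q} p⊕q≃0 = coeffwise λ d → begin
    coeff p d
      ≡⟨ solve 2 (λ x y → x := (x :+ y) :+ (:- con 1ℚ) :* y) refl (coeff p d) (coeff q d) ⟩
    (coeff p d +ℚ coeff q d) +ℚ -ℚ 1ℚ *ℚ coeff q d ≡⟨ cong₂ _+ℚ_ (trans (sym (coeff-++ p q d)) (≃⇒≈P p⊕q≃0 d)) (sym (coeff-scale (-ℚ 1ℚ) q d)) ⟩
    0ℚ +ℚ coeff (negP q) d
      ≡⟨ ℚP.+-identityˡ _ ⟩
    coeff (negP q) d ∎
    where
    open ≡-Reasoning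
    open ℚSolver.+-*-Solver

  target-sumP : ∀ q (us : List (Fin n)) → target q us ≡ negP (sumP (map (λ u → q u ⊗ oneMinus2 u) us)) ⊕ constP (-ℚ 1ℚ)
  target-sumP q []       = refl
  target-sumP q (u ∷ us) = begin
    negP (q u ⊗ oneMinus2 u) ⊕ target q us
      ≡⟨ cong (negP (q u ⊗ oneMinus2 u) ⊕_) (target-sumP q us) ⟩
    negP (q u ⊗ oneMinus2 u) ⊕ (negP (sumP (map f us)) ⊕ constP (-ℚ 1ℚ))
      ≡⟨ LP.++-assoc (negP (q u ⊗ oneMinus2 u)) (negP (sumP (map f us))) (constP (-ℚ 1ℚ)) ⟨
    (negP (q u ⊗ oneMinus2 u) ⊕ negP (sumP (map f us))) ⊕ constP (-ℚ 1ℚ)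
      ≡⟨ cong (_⊕ constP (-ℚ 1ℚ)) (negP-⊕ (q u ⊗ oneMinus2 u) (sumP (map f us))) ⟨
    negP (sumP (map f (u ∷ us))) ⊕ constP (-ℚ 1ℚ) ∎
    where
    open ≡-Reasoning
    f = λ u → q u ⊗ oneMinus2 u

  multilinP-⊗-oneMinus2 : ∀ u {L : Poly n} → AllMonos (ScopedBeforeᴹ u) L → multilinP (L ⊗ oneMinus2 u) ≡ multilinP L ⊗ oneMinus2 u
  multilinP-⊗-oneMinus2 u {[]}          []                      = refl
  multilinP-⊗-oneMinus2 u {(c , m) ∷ L} (scopedBefore s ∷ sL) = cong₃ (λ A B (rest : Poly n) → (c *ℚ 1ℚ , A) ∷ (c *ℚ (-ℚ two) , B) ∷ rest)
    (sym (multilin-·-oneM m)) (sym (multilin-·-fresh m (u , false) (proj₁ (s u ℕP.≤-refl)))) (multilinP-⊗-oneMinus2 u sL)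

  multilin-oneM : multilin (oneM {n}) ≡ oneM
  multilin-oneM = Mono-ext λ x → trans (expo-multilin oneM x) (trans (cong clip (expo-oneM x)) (sym (expo-oneM x)))

  ScopedBeforeᴹ-multilin : ∀ {k : Fin n} {m : Mono n} → ScopedBeforeᴹ k m → ScopedBeforeᴹ k (multilin m)
  ScopedBeforeᴹ-multilin {m = m} (scopedBefore s) = scopedBefore λ i k≤i →
    trans (expo-multilin m (i , false)) (cong clip (proj₁ (s i k≤i))) ,
    trans (expo-multilin m (i , true))  (cong clip (proj₂ (s i k≤i)))

  multilinQ : (Fin n → Poly n) → Fin n → Poly n
  multilinQ qu u = multilinP (normalise (qu u))

  normalise-scoped : ∀ {q : Poly n} {u : Fin n} → ScopedBefore q u → AllMonos (ScopedBeforeᴹ u) (normalise q)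
  normalise-scoped {q} sb = mapᴬ (λ {t} q[t]≢0 → scopedBefore (sb (proj₂ t) q[t]≢0)) (normalise-supported q)

  multilinQ-scoped : ∀ qu {u} → ScopedBefore (qu u) u → Scoped (multilinQ qu) u
  multilinQ-scoped qu {u} sb = AllP.map⁺ (mapᴬ ScopedBeforeᴹ-multilin (normalise-scoped {qu u} {u} sb))

  multilinP-⊗-oneMinus2-normalise : ∀ qu {u} → ScopedBefore (qu u) u → multilinP (qu u ⊗ oneMinus2 u) ≃ multilinQ qu u ⊗ oneMinus2 u
  multilinP-⊗-oneMinus2-normalise qu {u} sb = ≃-trans
    (mapMono-resp-≃ multilin (⊗-congˡ (oneMinus2 u) (≃-sym (normalise-≃ (qu u)))))
    (≡⇒≃ (multilinP-⊗-oneMinus2 u (normalise-scoped {qu u} {u} sb)))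

  -- Multilinearisation commutes with multiplication by 1 − 2u on the normalised q_u, which does not mention u.
  multilin-identity : ∀ (qs ps : List (Poly n)) (us : List (Fin n)) qu → All (λ u → ScopedBefore (qu u) u) us →
    sumP (zipWith _⊗_ qs ps) ⊕ sumP (map (λ u → qu u ⊗ oneMinus2 u) us) ⊕ constP 1ℚ ≈P zeroP →
    multilinP (sumP (zipWith _⊗_ qs ps)) ≃ target (multilinQ qu) (reverse us)
  multilin-identity qs ps us qu scoped identity = begin
    multilinP S
      ≈⟨ ⊕≃0⇒≃negP multilin-identity≃0 ⟩
    negP (multilinP U ⊕ constP 1ℚ)
      ≡⟨ negP-⊕ (multilinP U) (constP 1ℚ) ⟩
    negP (multilinP U) ⊕ negP (constP 1ℚ)
      ≈⟨ ⊕-cong (scale-resp-≃ (-ℚ 1ℚ) U≃) (≡⇒≃ (cong (λ c → (c , oneM) ∷ []) (ℚP.*-identityʳ (-ℚ 1ℚ)))) ⟩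
    negP (sumP (map g (reverse us))) ⊕ constP (-ℚ 1ℚ)
      ≡⟨ target-sumP (multilinQ qu) (reverse us) ⟨
    target (multilinQ qu) (reverse us) ∎
    where
    open SetoidReasoning ≃-setoid
    S = sumP (zipWith _⊗_ qs ps)
    U = sumP (map (λ u → qu u ⊗ oneMinus2 u) us)
    g = λ u → multilinQ qu u ⊗ oneMinus2 u
    multilin-identity≃0 : multilinP S ⊕ (multilinP U ⊕ constP 1ℚ) ≃ zeroP
    multilin-identity≃0 = ≃-trans
      (≡⇒≃ (sym (trans (multilinP-++ S (U ⊕ constP 1ℚ)) (cong (multilinP S ⊕_) (trans (multilinP-++ U (constP 1ℚ))
            (cong (λ M → multilinP U ⊕ ((1ℚ , M) ∷ [])) multilin-oneM))))))
      (mapMono-resp-≃ multilin (coeffwise identity))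
    U≃ : multilinP U ≃ sumP (map g (reverse us))
    U≃ = begin
      multilinP U
        ≡⟨ trans (multilinP-sumP (map (λ u → qu u ⊗ oneMinus2 u) us)) (cong sumP (sym (LP.map-∘ us))) ⟩
      sumP (map (λ u → multilinP (qu u ⊗ oneMinus2 u)) us)
        ≈⟨ sumP-map-resp {f = λ u → multilinP (qu u ⊗ oneMinus2 u)} {g = g} (multilinP-⊗-oneMinus2-normalise qu) scoped ⟩
      sumP (map g us)
        ≈⟨ sumP-reverse (map g us) ⟨
      sumP (reverse (map g us))
        ≡⟨ cong sumP (LP.reverse-map g us) ⟨
      sumP (map g (reverse us)) ∎

-- Building Q-PC derivations

totalSize : ∀ {n} → List (Poly n) → ℕ
totalSize ls = sum (map nmon ls)

totalSize-++ : ∀ {n} (as bs : List (Poly n)) → totalSize (as ++ bs) ≡ totalSize as + totalSize bs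
totalSize-++ as bs = trans (cong sum (LP.map-++ nmon as bs)) (SumP.sum-++ (map nmon as) (map nmon bs))

module Extending {n : ℕ} (Φ : QBF n) where

  record Extension {ls : List (Poly n)} (d : Deriv Φ ls) (P : Poly n → Set) (S Q : ℕ) : Set where
    constructor extension
    field
      added     : List (Poly n)
      extended  : Deriv Φ (added ++ ls)
      result    : Poly n
      result∈   : result ∈ added ++ ls
      result-ok : P result
      size≤     : totalSize added ≤ S
      qsize≤    : derivQsize extended ≤ derivQsize d + Q

  Continuation : List (Poly n) → (P P′ : Poly n → Set) (S Q : ℕ) → Set
  Continuation ls P P′ S Q = ∀ {ls′} (d′ : Deriv Φ ls′) → ls ⊆ ls′ → ∀ {h} → h ∈ ls′ → P h → Extension d′ P′ S Q

  derivQsize-subst : ∀ {ls ls′ : List (Poly n)} (eq : ls ≡ ls′) (d : Deriv Φ ls) → derivQsize (subst (Deriv Φ) eq d) ≡ derivQsize d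
  derivQsize-subst refl d = refl

  reuse : ∀ {ls P} (d : Deriv Φ ls) {h} → h ∈ ls → P h → Extension d P 0 0
  reuse d h∈ ok = extension [] d _ h∈ ok z≤n (ℕP.≤-reflexive (sym (ℕP.+-identityʳ _)))

  bind : ∀ {ls} {d : Deriv Φ ls} {P P′ S Q} S′ Q′ → Extension d P S Q → Continuation ls P P′ S′ Q′ → Extension d P′ (S + S′) (Q + Q′)
  bind {ls} {d} {S = S} {Q} S′ Q′ (extension new₁ d₁ h₁ h₁∈ ok₁ size₁ qsize₁) k
    with k d₁ (∈-++⁺ʳ new₁) h₁∈ ok₁
  ... | extension new₂ d₂ h₂ h₂∈ ok₂ size₂ qsize₂ =
    extension (new₂ ++ new₁) (subst (Deriv Φ) assoc d₂) h₂ (subst (h₂ ∈_) assoc h₂∈) ok₂ size-bound qsize-bound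
    where
    assoc : new₂ ++ new₁ ++ ls ≡ (new₂ ++ new₁) ++ ls
    assoc = sym (LP.++-assoc new₂ new₁ ls)
    size-bound : totalSize (new₂ ++ new₁) ≤ S + S′
    size-bound = begin
      totalSize (new₂ ++ new₁)             ≡⟨ totalSize-++ new₂ new₁ ⟩
      totalSize new₂ + totalSize new₁      ≤⟨ ℕP.+-mono-≤ size₂ size₁ ⟩
      S′ + S                               ≡⟨ ℕP.+-comm S′ S ⟩
      S + S′                               ∎
      where open ℕP.≤-Reasoning
    qsize-bound : derivQsize (subst (Deriv Φ) assoc d₂) ≤ derivQsize d + (Q + Q′)
    qsize-bound = begin
      derivQsize (subst (Deriv Φ) assoc d₂) ≡⟨ derivQsize-subst assoc d₂ ⟩
      derivQsize d₂
        ≤⟨ qsize₂ ⟩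
      derivQsize d₁ + Q′
        ≤⟨ ℕP.+-monoˡ-≤ Q′ qsize₁ ⟩
      derivQsize d + Q + Q′
        ≡⟨ ℕP.+-assoc (derivQsize d) Q Q′ ⟩
      derivQsize d + (Q + Q′) ∎
      where open ℕP.≤-Reasoning

  weaken : ∀ {ls} {d : Deriv Φ ls} {P P′ : Poly n → Set} {S Q S′ Q′} →
           (∀ {h} → P h → P′ h) → S ≤ S′ → Q ≤ Q′ → Extension d P S Q → Extension d P′ S′ Q′
  weaken P⇒P′ S≤S′ Q≤Q′ (extension new d′ h h∈ ok size qsize) =
    extension new d′ h h∈ (P⇒P′ ok) (ℕP.≤-trans size S≤S′) (ℕP.≤-trans qsize (ℕP.+-monoʳ-≤ _ Q≤Q′))

  step : ∀ {ls} (d : Deriv Φ ls) {p} (s : Step Φ ls p) {S Q} → nmon p ≤ S → stepQsize s ≤ Q → Extension d (_≡ p) S Q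
  step d {p} s size qsize =
    extension (p ∷ []) (d ▷ s) p (here refl) refl (ℕP.≤-trans (ℕP.≤-reflexive (ℕP.+-identityʳ _)) size) (ℕP.+-monoʳ-≤ (derivQsize d) qsize)

module Deriving {n : ℕ} (Φ : QBF n) where

  open Extending Φ

  E : List (Poly n)
  E = enc (QBF.matrix Φ)

  data Factor (p : Poly n) : Set where
    clause-factor : ∀ C → p ≡ clauseMono C → Factor p
    twin-factor   : ∀ i → p ≡ twinAx i → boolAx i ∈ E → Factor p

  -- Products with boolean axioms vanish after multilinearisation; only the other axioms serve as factors.
  data AxiomKind (p : Poly n) : Set where
    boolean : ∀ i → p ≡ boolAx i → AxiomKind p
    factor  : Factor p → AxiomKind p

  literalAxioms : Clause n → Fin n → List (Poly n)
  literalAxioms (clause P N) i = if lookup P i ∨ lookup N i then boolAx i ∷ twinAx i ∷ [] else []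

  axiomKind : ∀ {p} → p ∈ E → AxiomKind p
  axiomKind {p} p∈E with find (∈-concatMap⁻ encC {xs = QBF.matrix Φ} p∈E)
  ... | clause P N , C∈φ , here refl = factor (clause-factor (clause P N) refl)
  ... | C@(clause P N) , C∈φ , there p∈ with find (∈-concatMap⁻ (literalAxioms C) {xs = allFin n} p∈)
  ...   | i , i∈ , p∈Lᵢ with lookup P i ∨ lookup N i in occurs
  ...     | false = case p∈Lᵢ of λ ()
  ...     | true with p∈Lᵢ
  ...       | here refl         = boolean i refl
  ...       | there (here refl) = factor (twin-factor i refl bool∈E)
    where
    bool∈Lᵢ : boolAx i ∈ literalAxioms C i
    bool∈Lᵢ rewrite occurs = here refl
    bool∈E : boolAx i ∈ E
    bool∈E = ∈-concatMap⁺ encC (lose C∈φ (there (∈-concatMap⁺ (literalAxioms C) (lose i∈ bool∈Lᵢ))))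

  line : ∀ {ls} (d : Deriv Φ ls) {p} (s : Step Φ ls p) {S} → length p ≤ S → stepQsize s ≤ 0 → Extension d (_≡ p) S 0
  line d {p} s p≤S q≤0 = step d s (ℕP.≤-trans (nmon≤length {p = p} {p} ≃-refl) p≤S) q≤0

  length-varP-⊗ : ∀ x (q : Poly n) → length (varP x ⊗ q) ≡ length q
  length-varP-⊗ x q = trans (cong length (varP-⊗ x q)) (length-mapMono _ q)

  length-constP-⊗ : ∀ c (q : Poly n) → length (constP c ⊗ q) ≡ length q
  length-constP-⊗ c q = trans (cong length (constP-⊗ c q)) (length-scale c q)

  length-scaledProduct : ∀ c xs (b : Poly n) → length (constP c ⊗ mulMany xs b) ≡ length b
  length-scaledProduct c xs b = trans (length-constP-⊗ c (mulMany xs b)) (length-mulMany xs b)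

  multiplyBy : ∀ {ls} (d : Deriv Φ ls) xs {b} → b ∈ ls → Extension d (_≡ mulMany xs b) (length xs * length b) 0
  multiplyBy d []       b∈ = reuse d b∈ refl
  multiplyBy d (x ∷ xs) {b} b∈ = weaken id (ℕP.≤-reflexive (ℕP.+-comm (length xs * length b) (length b))) ℕP.≤-refl
    (bind (length b) 0 (multiplyBy d xs b∈) λ d′ _ h∈ → λ { refl →
      line d′ (mulV x h∈ (λ _ → refl)) (ℕP.≤-reflexive (trans (length-varP-⊗ x (mulMany xs b)) (length-mulMany xs b))) z≤n })

  scaledProduct : ∀ {ls} (d : Deriv Φ ls) c xs {b} → b ∈ ls → Extension d (_≡ constP c ⊗ mulMany xs b) (length xs * length b + length b) 0
  scaledProduct d c xs {b} b∈ = bind (length b) 0 (multiplyBy d xs b∈) λ d′ _ h∈ → λ { refl →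
    line d′ (mulQ c h∈ (λ _ → refl)) (ℕP.≤-reflexive (length-scaledProduct c xs b)) z≤n }

  TermOf : ℚ × Mono n → Poly n → Poly n → Set
  TermOf t p X = X ≃ multilinP (termTimes t p) × length X ≤ 5

  -- The costliest case, a twin axiom overlapping m, adds 20 monomials plus 5 per variable of m.
  termCost : ℕ
  termCost = 20 + (n + n) * 5

  termCost-bound : ∀ a b k L → a + b ≤ 20 → k ≤ 5 → L ≤ n + n → a + (L * k + b) ≤ termCost
  termCost-bound a b k L a+b≤20 k≤5 L≤2n = begin
    a + (L * k + b)  ≡⟨ cong (a +_) (ℕP.+-comm (L * k) b) ⟩
    a + (b + L * k)  ≡⟨ ℕP.+-assoc a b (L * k) ⟨
    a + b + L * k    ≤⟨ ℕP.+-mono-≤ a+b≤20 (ℕP.*-mono-≤ L≤2n k≤5) ⟩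
    termCost         ∎
    where open ℕP.≤-Reasoning

  deriveClauseTerm : ∀ {ls} (d : Deriv Φ ls) c m C → clauseMono C ∈ E → Extension d (TermOf (c , m) (clauseMono C)) termCost 0
  deriveClauseTerm d c m C@(clause P N) C∈E =
    weaken (λ { refl → ≡⇒≃ (multilin-clause c m C) , ℕP.≤-trans (ℕP.≤-reflexive (length-scaledProduct c xs X)) (ℕP.m≤m+n 1 4) })
           (termCost-bound 1 1 1 (length xs) (ℕP.m≤m+n 2 18) (ℕP.m≤m+n 1 4) (length-varsOf (residual m (clauseMonomial C)))) z≤n
      (bind (length xs * 1 + 1) 0 (line d (axiom {p = X} C∈E (λ _ → refl)) ℕP.≤-refl z≤n) λ d₁ _ h∈ → λ { refl →
       scaledProduct d₁ c xs h∈ })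
    where
    X  = clauseMono C
    xs = varsOf (residual m (clauseMonomial C))

  deriveTwinTermFresh : ∀ {ls} (d : Deriv Φ ls) c m i → twinAx i ∈ E → expo m (i , false) ≡ 0 → expo m (i , true) ≡ 0 →
                        Extension d (TermOf (c , m) (twinAx i)) termCost 0
  deriveTwinTermFresh d c m i twin∈E v∉m v̄∉m =
    weaken (λ { refl → ≡⇒≃ (multilin-twinAx-fresh c m i v∉m v̄∉m) , ℕP.≤-trans (ℕP.≤-reflexive (length-scaledProduct c xs (twinAx i))) (ℕP.m≤m+n 3 2) })
           (termCost-bound 3 3 3 (length xs) (ℕP.m≤m+n 6 14) (ℕP.m≤m+n 3 2) (length-varsOf m)) z≤n
      (bind (length xs * 3 + 3) 0 (line d (axiom {p = twinAx i} twin∈E (λ _ → refl)) ℕP.≤-refl z≤n) λ d₁ _ h∈ → λ { refl →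
       scaledProduct d₁ c xs h∈ })
    where xs = varsOf m

  deriveTwinTermOverlap : ∀ {ls} (d : Deriv Φ ls) c m i b → twinAx i ∈ E → boolAx i ∈ E → expo m (i , b) ≢ 0 →
                          Extension d (TermOf (c , m) (twinAx i)) termCost 0
  deriveTwinTermOverlap d c m i b twin∈E bool∈E m∋x =
    weaken (λ { refl → multilin-twinAx-overlap c m i b m∋x , ℕP.≤-reflexive (length-scaledProduct c xs comb) })
           (termCost-bound 15 5 5 (length xs) ℕP.≤-refl ℕP.≤-refl (length-varsOf (zeroAt i m))) z≤n
      (bind (3 + (2 + (2 + (5 + (length xs * 5 + 5))))) 0 (line d (axiom {p = tw} twin∈E (λ _ → refl)) ℕP.≤-refl z≤n) λ d₁ _ tw∈ → λ { refl →
       bind (2 + (2 + (5 + (length xs * 5 + 5)))) 0 (line d₁ (mulV {p = vtw} (i , false) tw∈ (λ _ → refl)) ℕP.≤-refl z≤n) λ d₂ _ vtw∈ → λ { refl →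
       bind (2 + (5 + (length xs * 5 + 5))) 0 (line d₂ (axiom {p = bx} bool∈E (λ _ → refl)) ℕP.≤-refl z≤n) λ d₃ ⊆₃ bx∈ → λ { refl →
       bind (5 + (length xs * 5 + 5)) 0 (line d₃ (mulQ {p = nbx} (-ℚ 1ℚ) bx∈ (λ _ → refl)) ℕP.≤-refl z≤n) λ d₄ ⊆₄ nbx∈ → λ { refl →
       bind (length xs * 5 + 5) 0 (line d₄ (add {p = comb} (⊆₄ (⊆₃ vtw∈)) nbx∈ (λ _ → refl)) ℕP.≤-refl z≤n) λ d₅ _ comb∈ → λ { refl →
       scaledProduct d₅ c xs comb∈ } } } } })
    where
    xs   = varsOf (zeroAt i m)
    tw   = twinAx i
    vtw  = varP (i , false) ⊗ twinAx i
    bx   = boolAx i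
    nbx  = constP (-ℚ 1ℚ) ⊗ boolAx i
    comb = bothAtCombination i

  deriveTerm : ∀ {ls} (d : Deriv Φ ls) t {p} → p ∈ E → Factor p → Extension d (TermOf t p) termCost 0
  deriveTerm d (c , m) p∈E (clause-factor C refl) = deriveClauseTerm d c m C p∈E
  deriveTerm d (c , m) p∈E (twin-factor i refl bool∈E) with expo m (i , false) in v-exp | expo m (i , true) in v̄-exp
  ... | zero  | zero  = deriveTwinTermFresh d c m i p∈E v-exp v̄-exp
  ... | suc _ | _     = deriveTwinTermOverlap d c m i false p∈E bool∈E (λ v-exp≡0 → ℕP.1+n≢0 (trans (sym v-exp) v-exp≡0))
  ... | zero  | suc _ = deriveTwinTermOverlap d c m i true  p∈E bool∈E (λ v̄-exp≡0 → ℕP.1+n≢0 (trans (sym v̄-exp) v̄-exp≡0))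

  Accumulated : Poly n → Poly n → Poly n → ℕ → ℕ → Poly n → Set
  Accumulated p A L R B A′ = A′ ≃ A ⊕ multilinP (L ⊗ p) × length A′ + 5 * R ≤ B

  budget-step : ∀ a x l R B → x ≤ 5 → a + 5 * (suc l + R) ≤ B → a + x + 5 * (l + R) ≤ B
  budget-step a x l R B x≤5 a+5[1+l+R]≤B = begin
    a + x + 5 * (l + R)    ≤⟨ ℕP.+-monoˡ-≤ (5 * (l + R)) (ℕP.+-monoʳ-≤ a x≤5) ⟩
    a + 5 + 5 * (l + R)    ≡⟨ trans (ℕP.+-assoc a 5 (5 * (l + R))) (cong (a +_) (sym (ℕP.*-suc 5 (l + R)))) ⟩
    a + 5 * (suc l + R)    ≤⟨ a+5[1+l+R]≤B ⟩
    B                      ∎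
    where open ℕP.≤-Reasoning

  accumulateTerms : ∀ {ls} (d : Deriv Φ ls) {p} → p ∈ E → Factor p → ∀ L R B {A} → A ∈ ls → length A + 5 * (length L + R) ≤ B →
                    Extension d (Accumulated p A L R B) (length L * (termCost + B)) 0
  accumulateTerms d p∈E fp []      R B {A} A∈ budget =
    reuse d A∈ (≃-sym (⊕-identityʳ ≃-refl) , budget)
  accumulateTerms d {p} p∈E fp (t ∷ L) R B {A} A∈ budget =
    weaken id (ℕP.≤-reflexive (sym (ℕP.+-assoc termCost B (length L * (termCost + B))))) ℕP.≤-refl
      (bind (B + length L * (termCost + B)) 0 (deriveTerm d t p∈E fp) λ { d₁ ⊆₁ {X} X∈ (X≃ , X≤5) →
       bind (length L * (termCost + B)) 0 (line d₁ (add {p = A ⊕ X} (⊆₁ A∈) X∈ (λ _ → refl)) (ℕP.≤-trans (ℕP.m≤m+n _ _) (budget′ X≤5)) z≤n)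
         λ d₂ _ A′∈ → λ { refl →
       weaken (λ { (A″≃ , A″≤B) → ≃-trans A″≃ (regroup X≃) , A″≤B }) ℕP.≤-refl ℕP.≤-refl
         (accumulateTerms d₂ p∈E fp L R B A′∈ (budget′ X≤5)) } })
    where
    budget′ : ∀ {X : Poly n} → length X ≤ 5 → length (A ⊕ X) + 5 * (length L + R) ≤ B
    budget′ {X} X≤5 = subst (λ k → k + 5 * (length L + R) ≤ B) (sym (LP.length-++ A))
                            (budget-step (length A) (length X) (length L) R B X≤5 budget)
    regroup : ∀ {X} → X ≃ multilinP (termTimes t p) → (A ⊕ X) ⊕ multilinP (L ⊗ p) ≃ A ⊕ multilinP ((t ∷ L) ⊗ p)
    regroup {X} X≃ = ≃-trans (⊕-assoc A X (multilinP (L ⊗ p)))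
      (⊕-cong ≃-refl (≃-trans (⊕-cong X≃ ≃-refl) (≡⇒≃ (sym (multilinP-++ (termTimes t p) (L ⊗ p))))))

  multilinP-⊗-boolAx : ∀ (L : Poly n) i → multilinP (L ⊗ boolAx i) ≃ zeroP
  multilinP-⊗-boolAx []      i = ≃-refl
  multilinP-⊗-boolAx (t ∷ L) i = ≃-trans (≡⇒≃ (multilinP-++ (termTimes t (boolAx i)) (L ⊗ boolAx i)))
                                   (≃-trans (⊕-cong (multilin-boolAx t i) (multilinP-⊗-boolAx L i)) ≃-refl)

  multiplierBudget : List (Poly n) → ℕ
  multiplierBudget qs = sum (map nmon qs)

  AccumulatedProducts : Poly n → List (Poly n) → List (Poly n) → ℕ → Poly n → Set
  AccumulatedProducts A qs ps B A′ = A′ ≃ A ⊕ multilinP (sumP (zipWith _⊗_ qs ps)) × length A′ ≤ B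

  accumulateProducts : ∀ {ls} (d : Deriv Φ ls) qs ps → All (_∈ E) ps → ∀ B {A} → A ∈ ls → length A + 5 * multiplierBudget qs ≤ B →
                       Extension d (AccumulatedProducts A qs ps B) (multiplierBudget qs * (termCost + B)) 0
  accumulateProducts d []       ps       _           B {A} A∈ budget = reuse d A∈ (≃-sym (⊕-identityʳ ≃-refl) , ℕP.≤-trans (ℕP.m≤m+n _ _) budget)
  accumulateProducts d (q ∷ qs) []       _           B {A} A∈ budget =
    weaken id z≤n z≤n (reuse d A∈ (≃-sym (⊕-identityʳ ≃-refl) , ℕP.≤-trans (ℕP.m≤m+n _ _) budget))
  accumulateProducts d (q ∷ qs) (p ∷ ps) (p∈E ∷ ps∈E) B {A} A∈ budget with axiomKind p∈E
  ... | boolean i refl =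
    weaken (λ { (A′≃ , A′≤B) → ≃-trans A′≃ (⊕-cong ≃-refl (drop-boolean i)) , A′≤B })
           (ℕP.*-monoˡ-≤ (termCost + B) (ℕP.m≤n+m _ (nmon q))) ℕP.≤-refl
      (accumulateProducts d qs ps ps∈E B A∈ (ℕP.≤-trans (ℕP.+-monoʳ-≤ (length A) (ℕP.*-monoʳ-≤ 5 (ℕP.m≤n+m _ (nmon q)))) budget))
    where
    drop-boolean : ∀ i → multilinP (sumP (zipWith _⊗_ qs ps)) ≃ multilinP (sumP (zipWith _⊗_ (q ∷ qs) (boolAx i ∷ ps)))
    drop-boolean i = ≃-sym (≃-trans (≡⇒≃ (multilinP-++ (q ⊗ boolAx i) _))
                                    (≃-trans (⊕-cong (multilinP-⊗-boolAx q i) ≃-refl) ≃-refl))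
  ... | factor fp =
    weaken id (ℕP.≤-reflexive size≡) ℕP.≤-refl
      (bind (multiplierBudget qs * (termCost + B)) 0 first λ { d₁ _ A₁∈ (A₁≃ , A₁-budget) →
        weaken (λ { (A₂≃ , A₂≤B) → ≃-trans A₂≃ (regroup A₁≃) , A₂≤B }) ℕP.≤-refl ℕP.≤-refl
          (accumulateProducts d₁ qs ps ps∈E B A₁∈ A₁-budget) })
    where
    first = accumulateTerms d p∈E fp (normalise q) (multiplierBudget qs) B A∈
              (subst (λ k → length A + 5 * (k + multiplierBudget qs) ≤ B) (sym (length-normalise q)) budget)
    size≡ : length (normalise q) * (termCost + B) + multiplierBudget qs * (termCost + B) ≡ multiplierBudget (q ∷ qs) * (termCost + B)
    size≡ = trans (cong (λ k → k * (termCost + B) + multiplierBudget qs * (termCost + B)) (length-normalise q))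
                  (sym (ℕP.*-distribʳ-+ (termCost + B) (nmon q) (multiplierBudget qs)))
    S′ = multilinP (sumP (zipWith _⊗_ qs ps))
    regroup : ∀ {A₁} → A₁ ≃ A ⊕ multilinP (normalise q ⊗ p) → A₁ ⊕ S′ ≃ A ⊕ multilinP (q ⊗ p ⊕ sumP (zipWith _⊗_ qs ps))
    regroup {A₁} A₁≃ = begin
      A₁ ⊕ S′
        ≈⟨ ⊕-cong A₁≃ ≃-refl ⟩
      (A ⊕ multilinP (normalise q ⊗ p)) ⊕ S′
        ≈⟨ ⊕-assoc A (multilinP (normalise q ⊗ p)) S′ ⟩
      A ⊕ (multilinP (normalise q ⊗ p) ⊕ S′)
        ≈⟨ ⊕-cong {p = A} ≃-refl (⊕-cong {q = S′} (mapMono-resp-≃ multilin (⊗-congˡ p (normalise-≃ q))) ≃-refl) ⟩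
      A ⊕ (multilinP (q ⊗ p) ⊕ S′)
        ≡⟨ cong (A ⊕_) (multilinP-++ (q ⊗ p) (sumP (zipWith _⊗_ qs ps))) ⟨
      A ⊕ multilinP (q ⊗ p ⊕ sumP (zipWith _⊗_ qs ps)) ∎
      where open SetoidReasoning ≃-setoid

module Reducing {n : ℕ} (Φ : QBF n) where

  open Extending Φ

  length-target-∷ : ∀ q u us → length (target q us) ≤ length (target {n} q (u ∷ us))
  length-target-∷ q u us = ℕP.≤-trans (ℕP.m≤n+m _ _) (ℕP.≤-reflexive (sym (LP.length-++ (negP (q u ⊗ oneMinus2 u)))))

  -- One round derives a|u=0 and a|u=1 by ∀-reduction, their sum, and half of it, which is the target without q_u.
  reduceAll : ∀ {ls} (d : Deriv Φ ls) q us Lm {a} → a ∈ ls → a ≃ target q us → length (target q us) ≤ Lm →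
              AllPairs (λ u u′ → u′ <F u) us → All (Universal Φ) us → All (Scoped q) us →
              Extension d (_≃ target q []) (length us * (5 * Lm)) (length us * (4 * Lm))
  reduceAll d q []       Lm a∈ a≃t _ _ _ _ = reuse d a∈ a≃t
  reduceAll d q (u ∷ us) Lm {a} a∈ a≃t t≤Lm (us<u ∷ sorted) (univ ∷ univs) scoped@(_ ∷ scoped′) =
    weaken id (ℕP.≤-reflexive (size≡ Lm (length us * (5 * Lm)))) (ℕP.≤-reflexive (qsize≡ Lm (length us * (4 * Lm))))
     (bind (Lm + (Lm + Lm + (Lm + length us * (5 * Lm)))) (Lm + Lm + (0 + (0 + length us * (4 * Lm))))
        (step d (∀red {p = r₀} u false univ a∈ exceptU (λ _ → refl)) (restrict≤ false) (ℕP.+-mono-≤ a≤ (restrict≤ false)))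
        λ d₁ ⊆₁ r₀∈ → λ { refl →
      bind (Lm + Lm + (Lm + length us * (5 * Lm))) (0 + (0 + length us * (4 * Lm)))
        (step d₁ (∀red {p = r₁} u true univ (⊆₁ a∈) exceptU (λ _ → refl)) (restrict≤ true) (ℕP.+-mono-≤ a≤ (restrict≤ true)))
        λ d₂ ⊆₂ r₁∈ → λ { refl →
      bind (Lm + length us * (5 * Lm)) (0 + length us * (4 * Lm))
        (step d₂ (add {p = r₀ ⊕ r₁} (⊆₂ r₀∈) r₁∈ (λ _ → refl)) sum≤ z≤n)
        λ d₃ _ s∈ → λ { refl →
      bind (length us * (5 * Lm)) (length us * (4 * Lm))
        (step d₃ (mulQ {p = a′} half s∈ (λ _ → refl)) a′≤ z≤n)
        λ d₄ _ a′∈ → λ { refl →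
      reduceAll d₄ q us Lm a′∈ a′≃t (ℕP.≤-trans (length-target-∷ q u us) t≤Lm) sorted univs scoped′ } } } })
    where
    r₀ = restrict a u false
    r₁ = restrict a u true
    a′ = constP half ⊗ (r₀ ⊕ r₁)
    a′≃t : a′ ≃ target q us
    a′≃t = ∀-reduce-target q u a≃t us<u scoped
    exceptU : ScopedExcept a u
    exceptU = target-ScopedExcept q u a≃t us<u scoped
    a≤ : nmon a ≤ Lm
    a≤ = ℕP.≤-trans (nmon≤length a≃t) t≤Lm
    restrict≤ : ∀ β → nmon (restrict a u β) ≤ Lm
    restrict≤ β = ℕP.≤-trans (nmon≤length (restrict-resp-≃ u β a≃t)) (ℕP.≤-trans (length-restrict (target q (u ∷ us)) u β) t≤Lm)
    sum≤ : nmon (r₀ ⊕ r₁) ≤ Lm + Lm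
    sum≤ = ℕP.≤-trans (nmon≤length (⊕-cong (restrict-resp-≃ u false a≃t) (restrict-resp-≃ u true a≃t)))
             (ℕP.≤-trans (ℕP.≤-reflexive (LP.length-++ (restrict (target q (u ∷ us)) u false)))
               (ℕP.+-mono-≤ (ℕP.≤-trans (length-restrict (target q (u ∷ us)) u false) t≤Lm)
                            (ℕP.≤-trans (length-restrict (target q (u ∷ us)) u true) t≤Lm)))
    a′≤ : nmon a′ ≤ Lm
    a′≤ = ℕP.≤-trans (nmon≤length a′≃t) (ℕP.≤-trans (length-target-∷ q u us) t≤Lm)
    size≡ : ∀ L R → L + (L + (L + L + (L + R))) ≡ 5 * L + R
    size≡ = solve 2 (λ L R → L :+ (L :+ (L :+ L :+ (L :+ R))) := con 5 :* L :+ R) refl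
      where open NatSolver
    qsize≡ : ∀ L R → L + L + (L + L + (0 + (0 + R))) ≡ 4 * L + R
    qsize≡ = solve 2 (λ L R → L :+ L :+ (L :+ L :+ (con 0 :+ (con 0 :+ R))) := con 4 :* L :+ R) refl
      where open NatSolver

All-reverse : ∀ {A : Set} {P : A → Set} {xs} → All P xs → All P (reverse xs)
All-reverse {xs = xs} = All-resp-↭ (↭-sym (↭-reverse xs))

AllPairs-reverse : ∀ {A : Set} {R : A → A → Set} {xs} → AllPairs R xs → AllPairs (λ x y → R y x) (reverse xs)
AllPairs-reverse {R = R} {[]}     []            = []
AllPairs-reverse {R = R} {x ∷ xs} (x~xs ∷ xs~) = subst (AllPairs (λ x y → R y x)) (sym (LP.unfold-reverse x xs))
  (AllPairsP.++⁺ (AllPairs-reverse xs~) ([] ∷ []) (mapᴬ (_∷ []) (All-reverse x~xs)))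

sum-reverse : ∀ xs → sum (reverse xs) ≡ sum xs
sum-reverse xs = SumP.sum-↭ (↭-reverse xs)

prefixTrue-const : ∀ {k} (Q : Vec Quant k) → prefixTrue Q (λ _ → true)
prefixTrue-const []        = refl
prefixTrue-const (∃q ∷ Q) = true , prefixTrue-const Q
prefixTrue-const (∀q ∷ Q) = λ _ → prefixTrue-const Q

-- A QBF with an empty matrix is true, so a false one has a clause to start a derivation from.
false⇒clause : ∀ {n} (Φ : QBF n) → QBFFalse Φ → ∃ λ C → clauseMono C ∈ enc (QBF.matrix Φ)
false⇒clause (qbf Q [])                 Φ-false = ⊥-elim (Φ-false (prefixTrue-const Q))
false⇒clause (qbf Q (clause P N ∷ φ)) _       = clause P N , here refl

module _ {n : ℕ} where

  univList-universal : ∀ (Φ : QBF n) → All (Universal Φ) (univList Φ)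
  univList-universal Φ = AllP.all-filter (λ u → lookup (QBF.prefix Φ) u ≟Q ∀q) (allFin n)

  univList-sorted : ∀ (Φ : QBF n) → AllPairs _<F_ (univList Φ)
  univList-sorted Φ = AllPairsP.filter⁺ (λ u → lookup (QBF.prefix Φ) u ≟Q ∀q) (AllPairsP.tabulate⁺-< id)

  length-univList : ∀ (Φ : QBF n) → length (univList Φ) ≤ n
  length-univList Φ = ℕP.≤-trans (LP.length-filter (λ u → lookup (QBF.prefix Φ) u ≟Q ∀q) (allFin n)) (ℕP.≤-reflexive (LP.length-tabulate id))

  length-target : ∀ qu (us : List (Fin n)) → length (target (multilinQ qu) us) ≡ 1 + 2 * sum (map (λ u → nmon (qu u)) us)
  length-target qu []       = refl
  length-target qu (u ∷ us) = begin
    length (negP (multilinQ qu u ⊗ oneMinus2 u) ⊕ target (multilinQ qu) us)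
      ≡⟨ LP.length-++ (negP (multilinQ qu u ⊗ oneMinus2 u)) ⟩
    length (negP (multilinQ qu u ⊗ oneMinus2 u)) + length (target (multilinQ qu) us)
      ≡⟨ cong₂ _+_ (trans (length-scale (-ℚ 1ℚ) (multilinQ qu u ⊗ oneMinus2 u)) (trans (length-⊗ (multilinQ qu u) (oneMinus2 u))
                     (cong (_* 2) (trans (length-mapMono multilin (normalise (qu u))) (length-normalise (qu u))))))
                   (length-target qu us) ⟩
    nmon (qu u) * 2 + (1 + 2 * s)
      ≡⟨ solve 2 (λ a s → a :* con 2 :+ (con 1 :+ con 2 :* s) := con 1 :+ con 2 :* (a :+ s)) refl (nmon (qu u)) s ⟩
    1 + 2 * (nmon (qu u) + s) ∎
    where
    open ≡-Reasoning
    open NatSolver using (solve; _:+_; _:*_; _:=_; con)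
    s = sum (map (λ u → nmon (qu u)) us)

module Simulation {n : ℕ} (Φ : QBF n) (π : QNS Φ) where

  open Extending Φ
  open Deriving Φ
  open Reducing Φ

  qs = QNS.qp π
  qu = QNS.qu π
  us = reverse (univList Φ)
  q  = multilinQ qu
  R  = multiplierBudget qs
  B  = 1 + 5 * R
  Lm = length (target q us)

  sizeBudget qsizeBudget : ℕ
  sizeBudget  = 1 + (1 + (R * (termCost + B) + length us * (5 * Lm)))
  qsizeBudget = 0 + (0 + (0 + length us * (4 * Lm)))

  scoped : All (λ u → ScopedBefore (qu u) u) (univList Φ)
  scoped = mapᴬ (QNS.quScope π _) (univList-universal Φ)

  -- Start from the zero polynomial 0·X, add up the multilinear products q·p, then ∀-reduce the universals innermost first.
  derivation : ∀ C → clauseMono C ∈ E → Extension [] (_≃ target q []) sizeBudget qsizeBudget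
  derivation C@(clause P N) X∈E =
    bind _ _ (line [] (axiom {p = X} X∈E (λ _ → refl)) ℕP.≤-refl z≤n) λ d₁ _ X∈ → λ { refl →
    bind _ _ (line d₁ (mulQ {p = Z} 0ℚ X∈ (λ _ → refl)) ℕP.≤-refl z≤n) λ d₂ _ Z∈ → λ { refl →
    bind _ _ (accumulateProducts d₂ qs E (tabulate id) B Z∈ ℕP.≤-refl) λ { d₃ _ D∈ (D≃ , _) →
    reduceAll d₃ q us Lm D∈ (D≃target D≃) ℕP.≤-refl
      (AllPairs-reverse (univList-sorted Φ)) (All-reverse (univList-universal Φ)) (All-reverse (mapᴬ (multilinQ-scoped qu) scoped)) } } }
    where
    X = clauseMono C
    Z = constP 0ℚ ⊗ X
    Z≃0 : Z ≃ zeroP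
    Z≃0 = coeffwise λ d → trans (cong (λ p → coeff p d) (constP-⊗ 0ℚ X)) (trans (coeff-scale 0ℚ X d) (ℚP.*-zeroˡ (coeff X d)))
    D≃target : ∀ {D} → D ≃ Z ⊕ multilinP (sumP (zipWith _⊗_ qs E)) → D ≃ target q us
    D≃target D≃ = ≃-trans D≃ (≃-trans (≃-trans (⊕-comm Z _) (⊕-identityʳ Z≃0))
                    (multilin-identity qs E (univList Φ) qu scoped (QNS.identity π)))

  refutation : ∀ C → clauseMono C ∈ E → Σ (QPC Φ) λ π′ → QPCsize π′ ≤ 1 + sizeBudget × QPCQsize π′ ≤ qsizeBudget
  refutation C X∈E =
    record { lastLine = one ; earlier = added ++ [] ; deriv = extended ▷ mulQ (-ℚ 1ℚ) result∈ (λ _ → refl) ; isOne = ≃⇒≈P one≃1 } ,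
    ℕP.+-mono-≤ (nmon≤length one≃1) (subst (λ ls → totalSize ls ≤ sizeBudget) (sym (LP.++-identityʳ added)) size≤) ,
    ℕP.≤-trans (ℕP.≤-reflexive (ℕP.+-identityʳ _)) qsize≤
    where
    open Extension (derivation C X∈E)
    one = constP (-ℚ 1ℚ) ⊗ result
    one≃1 : one ≃ constP 1ℚ
    one≃1 = negate-target-[] q result-ok

  length-us : length us ≤ n
  length-us = ℕP.≤-trans (ℕP.≤-reflexive (LP.length-reverse (univList Φ))) (length-univList Φ)

  Lm≡ : Lm ≡ 1 + 2 * QNSQsize π
  Lm≡ = trans (length-target qu us) (cong (λ s → 1 + 2 * s)
          (trans (cong sum (LP.reverse-map (λ u → nmon (qu u)) (univList Φ))) (sum-reverse (map (λ u → nmon (qu u)) (univList Φ)))))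

bound : List ℕ
bound = 3 ∷ 26 ∷ 25 ∷ []

size-arithmetic : ∀ R QQ n k L s → L ≡ 1 + 2 * QQ → k ≤ n → n ≤ s →
  1 + (1 + (1 + (R * ((20 + (n + n) * 5) + (1 + 5 * R)) + k * (5 * L)))) ≤ evalPoly bound (R + QQ + s)
size-arithmetic R QQ n k L s refl k≤n n≤s = begin
  3 + (R * ((20 + (n + n) * 5) + (1 + 5 * R)) + k * (5 * (1 + 2 * QQ)))
    ≤⟨ ℕP.+-monoʳ-≤ 3 (ℕP.+-mono-≤ (ℕP.*-mono-≤ R≤X (ℕP.+-mono-≤ (ℕP.+-monoʳ-≤ 20 (ℕP.*-monoˡ-≤ 5 (ℕP.+-mono-≤ n≤X n≤X)))
                                                                  (ℕP.+-monoʳ-≤ 1 (ℕP.*-monoʳ-≤ 5 R≤X))))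
                                    (ℕP.*-mono-≤ (ℕP.≤-trans k≤n n≤X) (ℕP.*-monoʳ-≤ 5 (ℕP.+-monoʳ-≤ 1 (ℕP.*-monoʳ-≤ 2 QQ≤X))))) ⟩
  3 + (X * ((20 + (X + X) * 5) + (1 + 5 * X)) + X * (5 * (1 + 2 * X)))
    ≡⟨ solve 1 (λ X → con 3 :+ (X :* ((con 20 :+ (X :+ X) :* con 5) :+ (con 1 :+ con 5 :* X)) :+ X :* (con 5 :* (con 1 :+ con 2 :* X)))
                   := con 3 :+ X :* (con 26 :+ X :* (con 25 :+ X :* con 0))) refl X ⟩
  evalPoly bound X ∎
  where
  open ℕP.≤-Reasoning
  open NatSolver using (solve; _:+_; _:*_; _:=_; con)
  X = R + QQ + s
  R≤X  = ℕP.≤-trans (ℕP.m≤m+n R QQ) (ℕP.m≤m+n (R + QQ) s)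
  QQ≤X = ℕP.≤-trans (ℕP.m≤n+m QQ R) (ℕP.m≤m+n (R + QQ) s)
  n≤X  = ℕP.≤-trans n≤s (ℕP.m≤n+m s (R + QQ))

qsize-arithmetic : ∀ QQ n k L s → L ≡ 1 + 2 * QQ → k ≤ n → n ≤ s → k * (4 * L) ≤ evalPoly bound (QQ + s)
qsize-arithmetic QQ n k L s refl k≤n n≤s = begin
  k * (4 * (1 + 2 * QQ))
    ≤⟨ ℕP.*-mono-≤ (ℕP.≤-trans k≤n (ℕP.≤-trans n≤s (ℕP.m≤n+m s QQ)))
                   (ℕP.*-monoʳ-≤ 4 (ℕP.+-monoʳ-≤ 1 (ℕP.*-monoʳ-≤ 2 (ℕP.m≤m+n QQ s)))) ⟩
  X * (4 * (1 + 2 * X))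
    ≤⟨ ℕP.m≤m+n _ (3 + X * (22 + X * 17)) ⟩
  X * (4 * (1 + 2 * X)) + (3 + X * (22 + X * 17))
    ≡⟨ solve 1 (λ X → X :* (con 4 :* (con 1 :+ con 2 :* X)) :+ (con 3 :+ X :* (con 22 :+ X :* con 17))
                   := con 3 :+ X :* (con 26 :+ X :* (con 25 :+ X :* con 0))) refl X ⟩
  evalPoly bound X ∎
  where
  open ℕP.≤-Reasoning
  open NatSolver using (solve; _:+_; _:*_; _:=_; con)
  X = QQ + s

module SimulationBounds {n : ℕ} (Φ : QBF n) (π : QNS Φ) (n≤|Φ| : n ≤ qbfSize Φ) where

  open Simulation Φ π

  size-bound : 1 + sizeBudget ≤ evalPoly bound (QNSsize π + qbfSize Φ)
  size-bound = size-arithmetic R (QNSQsize π) n (length us) Lm (qbfSize Φ) Lm≡ length-us n≤|Φ|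

  qsize-bound : qsizeBudget ≤ evalPoly bound (QNSQsize π + qbfSize Φ)
  qsize-bound = qsize-arithmetic (QNSQsize π) n (length us) Lm (qbfSize Φ) Lm≡ length-us n≤|Φ|

simulation : ∀ {n} (Φ : QBF n) → QBFFalse Φ → (π : QNS Φ) →
             Σ (QPC Φ) λ π′ → QPCsize π′ ≤ evalPoly bound (QNSsize π + qbfSize Φ) × QPCQsize π′ ≤ evalPoly bound (QNSQsize π + qbfSize Φ)
simulation {n} Φ@(qbf Q φ) Φ-false π =
  π′ , ℕP.≤-trans size size-bound , ℕP.≤-trans qsize qsize-bound
  where
  open SimulationBounds Φ π (ℕP.m≤m+n n _)
  refuted = Simulation.refutation Φ π (proj₁ (false⇒clause Φ Φ-false)) (proj₂ (false⇒clause Φ Φ-false))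
  π′    = proj₁ refuted
  size  = proj₁ (proj₂ refuted)
  qsize = proj₂ (proj₂ refuted)

theorem7p4 : PSimulates QPC QNS QPCsize QNSsize × PSimulates QPC QNS QPCQsize QNSQsize
theorem7p4 = (bound , λ _ Φ Φ-false π → map₂ proj₁ (simulation Φ Φ-false π))
           , (bound , λ _ Φ Φ-false π → map₂ proj₂ (simulation Φ Φ-false π))
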